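{- Let $n\ge 3$, let $F\subseteq E(BH_n)$ with $|F|=4n-5$, and suppose $\delta(BH_n-F)\ge 2$. Then at least one of the following holds. (1) There is an integer $m\in\{0,1,\dots,n-1\}$ such that $|F\cap\partial D_m|\ge 3$ and every vertex has at least $2$ neighbours in $BH_n-\partial D_m-F$ (i.e. $\delta(BH_n-\partial D_m-F)\ge 2$). (2) There are two integers $m,m'\in\{0,1,\dots,n-1\}$ such that $|F\cap\partial D_m|\ge 2$ and $|F\cap\partial D_{m'}|\ge 2$, and moreover, for $d\in\{m,m'\}$, the graph $BH_n-\partial D_d-F$ has no isolated vertex and at most one vertex of degree exactly $1$.
   Context: The $n$-dimensional balanced hypercube $BH_n$ has vertex set $\{0,1,2,3\}^n$, vertices written $(a_0,a_1,\dots,a_{n-1})$; coordinate arithmetic is modulo $4$. A vertex $(a_0,\dots,a_{n-1})$ is adjacent exactly to $(a_0\pm 1,a_1,\dots,a_{n-1})$ and, for each $1\le i\le n-1$, to $(a_0\pm1,a_1,\dots,a_{i-1},a_i+(-1)^{a_0},a_{i+1},\dots,a_{n-1})$. An edge $(u,v)$ is a $0$-dimension edge if $u,v$ differ only in the coordinate $a_0$, and an $i$-dimension edge ($1\le i\le n-1$) if $u,v$ differ in $a_0$ and in $a_i$. $\partial D_d$ denotes the set of all $d$-dimension edges. The paper phrases the degree conditions via: given the fault set $F$, a vertex $u$ is called $i$-rescuable in a subgraph $G$ if $|N_{G-F}(u)|=i$. -}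

module Defs where

open import Data.Nat using (ℕ; zero; suc; _≤_)
open import Data.Fin using (Fin; zero; suc)
open import Data.Vec using (Vec; []; _∷_; lookup; _[_]%=_)
open import Data.Product using (Σ; ∃; _×_; _,_; proj₁; proj₂)
open import Data.Sum using (_⊎_)
open import Data.Empty using (⊥)
open import Data.List using (List; length)
open import Data.List.Relation.Unary.All using (All)
open import Data.List.Relation.Unary.Any using (Any)
open import Data.List.Relation.Unary.AllPairs using (AllPairs)
open import Data.List.Relation.Binary.Sublist.Propositional using (_⊆_)
open import Relation.Nullary using (¬_)
open import Relation.Binary.PropositionalEquality using (_≡_; _≢_)

inc4 : Fin 4 → Fin 4
inc4 zero = suc zero
inc4 (suc zero) = suc (suc zero)
inc4 (suc (suc zero)) = suc (suc (suc zero))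
inc4 (suc (suc (suc zero))) = zero

dec4 : Fin 4 → Fin 4
dec4 zero = suc (suc (suc zero))
dec4 (suc zero) = zero
dec4 (suc (suc zero)) = suc zero
dec4 (suc (suc (suc zero))) = suc (suc zero)

-- x ↦ x + (-1)^a  (mod 4)
step : Fin 4 → Fin 4 → Fin 4
step zero = inc4
step (suc zero) = dec4
step (suc (suc zero)) = inc4
step (suc (suc (suc zero))) = dec4

-- Vertices of BH_n: (a_0, a_1, ..., a_{n-1}) ∈ {0,1,2,3}^n ; head of the vector is a_0
Vertex : ℕ → Set
Vertex n = Vec (Fin 4) n

-- Adjacency in BH_n. For (a ∷ u), coordinate a_{i+1} is lookup u i.
Adj : ∀ {n} → Vertex n → Vertex n → Set
Adj [] [] = ⊥
Adj (a ∷ u) (b ∷ v) =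
  (b ≡ inc4 a ⊎ b ≡ dec4 a) × (v ≡ u ⊎ Σ (Fin _) λ i → v ≡ (u [ i ]%= step a))

-- d-dimension edge (d : Fin n; d = zero is dimension 0, d = suc i is dimension i+1)
-- dimension 0 : the endpoints differ only in a_0;
-- dimension i+1 : the endpoints differ (besides a_0) exactly in a_{i+1}.
Dim : ∀ {n} → Fin n → Vertex n → Vertex n → Set
Dim zero (a ∷ u) (b ∷ v) = u ≡ v
Dim (suc i) (a ∷ u) (b ∷ v) =
  (lookup u i ≢ lookup v i) × (∀ j → j ≢ i → lookup u j ≡ lookup v j)

Edge : ℕ → Set
Edge n = Vertex n × Vertex n

SameEdge : ∀ {n} → Edge n → Edge n → Set
SameEdge (u , v) (u' , v') = (u ≡ u' × v ≡ v') ⊎ (u ≡ v' × v ≡ u')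

-- F is a set of edges of BH_n (listed without repetition, orientation irrelevant)
IsEdgeSet : ∀ {n} → List (Edge n) → Set
IsEdgeSet F = All (λ e → Adj (proj₁ e) (proj₂ e)) F × AllPairs (λ e e' → ¬ SameEdge e e') F

InF : ∀ {n} → List (Edge n) → Vertex n → Vertex n → Set
InF F u v = Any (SameEdge (u , v)) F

Nbr : ∀ {n} → List (Edge n) → (Vertex n → Vertex n → Set) → Vertex n → Vertex n → Set
Nbr F R u v = Adj u v × ¬ InF F u v × ¬ R u v

NoEdges : ∀ {n} → Vertex n → Vertex n → Set
NoEdges _ _ = ⊥

Deg≥1 : ∀ {n} → List (Edge n) → (Vertex n → Vertex n → Set) → Vertex n → Set
Deg≥1 F R u = ∃ λ v → Nbr F R u v

Deg≥2 : ∀ {n} → List (Edge n) → (Vertex n → Vertex n → Set) → Vertex n → Set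
Deg≥2 F R u = ∃ λ v → ∃ λ w → v ≢ w × Nbr F R u v × Nbr F R u w

Deg≡1 : ∀ {n} → List (Edge n) → (Vertex n → Vertex n → Set) → Vertex n → Set
Deg≡1 F R u = Deg≥1 F R u × ¬ Deg≥2 F R u

MinDeg≥2 : ∀ {n} → List (Edge n) → (Vertex n → Vertex n → Set) → Set
MinDeg≥2 F R = ∀ u → Deg≥2 F R u

NoIsoAtMostOneDeg1 : ∀ {n} → List (Edge n) → (Vertex n → Vertex n → Set) → Set
NoIsoAtMostOneDeg1 F R =
  (∀ u → Deg≥1 F R u) × (∀ u u' → Deg≡1 F R u → Deg≡1 F R u' → u ≡ u')

-- |F ∩ ∂D_m| ≥ k : k distinct members of F that are m-dimension edges
DimCount≥ : ∀ {n} → List (Edge n) → Fin n → ℕ → Set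
DimCount≥ F m k = Σ (List (Edge _)) λ S →
  S ⊆ F × k ≤ length S × All (λ e → Dim m (proj₁ e) (proj₂ e)) S

-- Each vertex of BH_n has exactly two neighbours in every dimension, so deleting ∂D_m lowers a
-- degree by at most 2; only a vertex of degree at most 3 in BH_n − F (a "low" vertex) can end up with
-- degree at most 1 in BH_n − ∂D_m − F. A low vertex meets at least 2n − 3 faults, and two vertices
-- share at most one fault, none if they have the same parity because BH_n is bipartite. With only
-- 4n − 5 faults this leaves at most three low vertices, each of degree exactly 3 when there are three.
-- Some dimension carries at least 3 faults, since n dimensions with at most 2 each hold fewer than
-- 4n − 5; and a vertex whose two m-edges are both faulty forces 2 faults into ∂D_m (3 if two vertices
-- do). A case analysis on the low vertices then yields alternative (1) or (2).

module Submission where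

open import Defs
open import Data.Nat using (ℕ; zero; suc; _+_; _*_; _∸_; _≤_; z≤n; s≤s; _≤?_; _≟_)
open import Data.Nat.Properties
  using (≤-refl; ≤-trans; ≤-reflexive; ≤-antisym; ≤-pred; +-mono-≤; +-monoˡ-≤; +-monoʳ-≤; +-cancelˡ-≤; +-cancelʳ-≤;
         +-comm; +-identityʳ; *-identityʳ; *-zeroʳ; *-monoʳ-≤; *-monoˡ-≤; m≤m+n; m≤n+m; n≤1+n; m∸n+n≡m;
         ≰⇒>; n≤0⇒n≡0; n≢0⇒n>0; ≤⇒≯; +-0-commutativeMonoid; module ≤-Reasoning)
open import Data.Nat.Tactic.RingSolver using (solve; solve-∀)
open import Data.Bool using (Bool; true; false; not; _∧_; _∨_; _xor_)
open import Data.Bool.Properties using (not-¬; ∧-identityʳ; ∧-zeroʳ)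
open import Data.Fin using (Fin; zero; suc; punchIn; punchOut) renaming (_≟_ to _≟ᶠ_)
open import Data.Fin.Properties using (suc-injective; punchInᵢ≢i; punchIn-punchOut; punchIn-injective)
import Data.Fin.Properties as Finₚ
open import Data.Vec using (Vec; []; _∷_; head; lookup; _[_]%=_)
open import Data.Vec.Properties using (≡-dec; lookup∘updateAt; lookup∘updateAt′; updateAt-updateAt-local; updateAt-id)
open import Data.List using (List; []; _∷_; [_]; length; filter)
open import Data.List.Membership.Propositional using (_∈_; _∉_)
open import Data.List.Relation.Unary.All using (All; []; _∷_)
import Data.List.Relation.Unary.All as All
open import Data.List.Relation.Unary.All.Properties using (all-filter)
open import Data.List.Relation.Unary.Any using (any?; here; there)
open import Data.List.Relation.Unary.AllPairs using (AllPairs; []; _∷_)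
open import Data.List.Relation.Binary.Sublist.Propositional.Properties using (filter-⊆)
open import Data.List.Relation.Binary.Permutation.Propositional using (_↭_; prep; swap; ↭-refl; ↭-trans)
open import Data.List.Relation.Binary.Permutation.Propositional.Properties using (∈-resp-↭)
open import Data.Product using (Σ; _×_; _,_; proj₁; proj₂)
open import Data.Sum using (_⊎_; inj₁; inj₂)
open import Data.Empty using (⊥; ⊥-elim)
open import Function using (_∘_; _∋_)
open import Relation.Nullary using (¬_; Dec; yes; no; does; contradiction)
open import Relation.Nullary.Decidable
  using (True; toWitness; map′; _×-dec_; _⊎-dec_; _→-dec_; ¬?; dec-true; dec-false; decidable-stable)
open import Relation.Binary.PropositionalEquality using (_≡_; _≢_; refl; sym; trans; cong; cong₂; subst; module ≡-Reasoning)
open import Algebra.Properties.CommutativeMonoid.Sum +-0-commutativeMonoid using (sum; sum-remove; ∑-distrib-+; sum-cong-≗)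

-- Neighbours in BH_n

shift : Bool → Fin 4 → Fin 4
shift true = inc4
shift false = dec4

even : Fin 4 → Bool
even zero = true
even (suc zero) = false
even (suc (suc zero)) = true
even (suc (suc (suc zero))) = false

step≡shift-even : ∀ a c → step a c ≡ shift (even a) c
step≡shift-even zero c = refl
step≡shift-even (suc zero) c = refl
step≡shift-even (suc (suc zero)) c = refl
step≡shift-even (suc (suc (suc zero))) c = refl

even-shift : ∀ s a → even (shift s a) ≡ not (even a)
even-shift true zero = refl
even-shift true (suc zero) = refl
even-shift true (suc (suc zero)) = refl
even-shift true (suc (suc (suc zero))) = refl
even-shift false zero = refl
even-shift false (suc zero) = refl
even-shift false (suc (suc zero)) = refl
even-shift false (suc (suc (suc zero))) = refl

shift-true≢shift-false : ∀ a → shift true a ≢ shift false a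
shift-true≢shift-false zero ()
shift-true≢shift-false (suc zero) ()
shift-true≢shift-false (suc (suc zero)) ()
shift-true≢shift-false (suc (suc (suc zero))) ()

shift≢id : ∀ s a → shift s a ≢ a
shift≢id s a eq = not-¬ (cong even eq) (even-shift s a)

shift-inverse : ∀ s a → shift (not s) (shift s a) ≡ a
shift-inverse true zero = refl
shift-inverse true (suc zero) = refl
shift-inverse true (suc (suc zero)) = refl
shift-inverse true (suc (suc (suc zero))) = refl
shift-inverse false zero = refl
shift-inverse false (suc zero) = refl
shift-inverse false (suc (suc zero)) = refl
shift-inverse false (suc (suc (suc zero))) = refl

-- Moving along any edge flips the parity of a₀, so the step direction flips with it.
step-shift-inverse : ∀ s a c → step (shift s a) (step a c) ≡ c
step-shift-inverse s a c
  rewrite step≡shift-even (shift s a) (step a c) | even-shift s a | step≡shift-even a c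
  = shift-inverse (even a) c

step≢id : ∀ a c → step a c ≢ c
step≢id a c eq = shift≢id (even a) c (trans (sym (step≡shift-even a c)) eq)

neighbour : ∀ {k} → Vertex (suc k) → Fin (suc k) → Bool → Vertex (suc k)
neighbour (a ∷ u) zero s = shift s a ∷ u
neighbour (a ∷ u) (suc i) s = shift s a ∷ (u [ i ]%= step a)

parity : ∀ {k} → Vertex (suc k) → Bool
parity (a ∷ _) = even a

module _ {k : ℕ} where

  private
    V = Vertex (suc k)

  neighbour-adj : ∀ (x : V) m s → Adj x (neighbour x m s)
  neighbour-adj (a ∷ u) zero true = inj₁ refl , inj₁ refl
  neighbour-adj (a ∷ u) zero false = inj₂ refl , inj₁ refl
  neighbour-adj (a ∷ u) (suc i) true = inj₁ refl , inj₂ (i , refl)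
  neighbour-adj (a ∷ u) (suc i) false = inj₂ refl , inj₂ (i , refl)

  adj⇒neighbour : ∀ (x y : V) → Adj x y → Σ (Fin (suc k)) λ m → Σ Bool λ s → y ≡ neighbour x m s
  adj⇒neighbour (a ∷ u) (b ∷ v) (inj₁ refl , inj₁ refl) = zero , true , refl
  adj⇒neighbour (a ∷ u) (b ∷ v) (inj₂ refl , inj₁ refl) = zero , false , refl
  adj⇒neighbour (a ∷ u) (b ∷ v) (inj₁ refl , inj₂ (i , refl)) = suc i , true , refl
  adj⇒neighbour (a ∷ u) (b ∷ v) (inj₂ refl , inj₂ (i , refl)) = suc i , false , refl

  neighbour-dim : ∀ (x : V) m s → Dim m x (neighbour x m s)
  neighbour-dim (a ∷ u) zero s = refl
  neighbour-dim (a ∷ u) (suc i) s =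
    (λ eq → step≢id a (lookup u i) (trans (sym (lookup∘updateAt i u)) (sym eq))) ,
    (λ j j≢i → sym (lookup∘updateAt′ j i j≢i u))

  dim-unique : ∀ {m m'} (x y : V) → Dim m x y → Dim m' x y → m ≡ m'
  dim-unique {zero} {zero} (a ∷ u) (b ∷ v) _ _ = refl
  dim-unique {zero} {suc j} (a ∷ u) (b ∷ v) refl (ne , _) = contradiction refl ne
  dim-unique {suc i} {zero} (a ∷ u) (b ∷ v) (ne , _) refl = contradiction refl ne
  dim-unique {suc i} {suc j} (a ∷ u) (b ∷ v) (ne , _) (_ , same') with i ≟ᶠ j
  ... | yes i≡j = cong suc i≡j
  ... | no i≢j = contradiction (same' i i≢j) ne

  dim-sym : ∀ {m} (x y : V) → Dim m x y → Dim m y x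
  dim-sym {zero} (a ∷ u) (b ∷ v) eq = sym eq
  dim-sym {suc i} (a ∷ u) (b ∷ v) (ne , same) = (λ eq → ne (sym eq)) , λ j j≢i → sym (same j j≢i)

  neighbour-dimʳ : ∀ (x : V) m s → Dim m (neighbour x m s) x
  neighbour-dimʳ x m s = dim-sym x (neighbour x m s) (neighbour-dim x m s)

  head-neighbour : ∀ a (u : Vec (Fin 4) k) m s → head (neighbour (a ∷ u) m s) ≡ shift s a
  head-neighbour a u zero s = refl
  head-neighbour a u (suc i) s = refl

  neighbour-injective : ∀ (x : V) {m m' s s'} → neighbour x m s ≡ neighbour x m' s' → m ≡ m' × s ≡ s'
  neighbour-injective x {m} {m'} {s} {s'} eq with m ≟ᶠ m'
  ... | no m≢m' = contradiction (dim-unique x _ (neighbour-dim x m s) (subst (Dim m' x) (sym eq) (neighbour-dim x m' s'))) m≢m'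
  neighbour-injective x {s = true} {true} eq | yes refl = refl , refl
  neighbour-injective x {s = false} {false} eq | yes refl = refl , refl
  neighbour-injective (a ∷ u) {m} {s = true} {false} eq | yes refl =
    contradiction (trans (sym (head-neighbour a u m true)) (trans (cong head eq) (head-neighbour a u m false))) (shift-true≢shift-false a)
  neighbour-injective (a ∷ u) {m} {s = false} {true} eq | yes refl =
    contradiction (trans (sym (head-neighbour a u m true)) (trans (cong head (sym eq)) (head-neighbour a u m false))) (shift-true≢shift-false a)

  neighbour-inverse : ∀ (x : V) m s → neighbour (neighbour x m s) m (not s) ≡ x
  neighbour-inverse (a ∷ u) zero s = cong (_∷ u) (shift-inverse s a)
  neighbour-inverse (a ∷ u) (suc i) s = cong₂ _∷_ (shift-inverse s a)
    (trans (updateAt-updateAt-local i u (step-shift-inverse s a (lookup u i))) (updateAt-id i u))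

  adj-sym : ∀ (x y : V) → Adj x y → Adj y x
  adj-sym x y xy with adj⇒neighbour x y xy
  ... | m , s , refl = subst (Adj (neighbour x m s)) (neighbour-inverse x m s) (neighbour-adj _ m (not s))

  parity-neighbour : ∀ (x : V) m s → parity (neighbour x m s) ≡ not (parity x)
  parity-neighbour (a ∷ u) zero s = even-shift s a
  parity-neighbour (a ∷ u) (suc i) s = even-shift s a

  adj⇒parity≢ : ∀ (x y : V) → Adj x y → parity x ≢ parity y
  adj⇒parity≢ x y xy eq with adj⇒neighbour x y xy
  ... | m , s , refl = not-¬ (sym eq) (parity-neighbour x m s)

  neighbour≢self : ∀ (x : V) m s → neighbour x m s ≢ x
  neighbour≢self x m s eq = adj⇒parity≢ x _ (neighbour-adj x m s) (cong parity (sym eq))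

-- Opaque: unfolding this search over all 4ⁿ vertices makes type checking blow up.
opaque
  ∃-vertex? : ∀ {l} (P : Vertex l → Set) → (∀ x → Dec (P x)) → Dec (Σ (Vertex l) P)
  ∃-vertex? {zero} P P? = map′ ([] ,_) (λ { ([] , p) → p }) (P? [])
  ∃-vertex? {suc l} P P? = map′ (λ (a , u , p) → a ∷ u , p) (λ { (a ∷ u , p) → a , u , p })
    (Finₚ.any? λ a → ∃-vertex? (P ∘ (a ∷_)) (P? ∘ (a ∷_)))

-- Indicators and finite sums

𝟙 : Bool → ℕ
𝟙 true = 1
𝟙 false = 0

𝟙≤1 : ∀ b → 𝟙 b ≤ 1
𝟙≤1 true = s≤s z≤n
𝟙≤1 false = z≤n

does-true : ∀ {P : Set} (d : Dec P) → does d ≡ true → P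
does-true (yes p) _ = p

does-false : ∀ {P : Set} (d : Dec P) → does d ≡ false → ¬ P
does-false (no ¬p) _ = ¬p

private
  decide-≤ : ∀ {m n} {_ : True (m ≤? n)} → m ≤ n
  decide-≤ {_} {_} {p} = toWitness p

𝟙-does-mono : ∀ {P Q : Set} → (P → Q) → (p : Dec P) (q : Dec Q) → 𝟙 (does p) ≤ 𝟙 (does q)
𝟙-does-mono P⇒Q (yes p) (yes q) = ≤-refl
𝟙-does-mono P⇒Q (yes p) (no ¬q) = contradiction (P⇒Q p) ¬q
𝟙-does-mono P⇒Q (no _) q = z≤n

inclusion-exclusion₂ : ∀ a b → 𝟙 a + 𝟙 b ≤ 1 + 𝟙 (a ∧ b)
inclusion-exclusion₂ false b = 𝟙≤1 b
inclusion-exclusion₂ true b = ≤-refl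

inclusion-exclusion₃ : ∀ a b c → 𝟙 a + 𝟙 b + 𝟙 c ≤ 1 + (𝟙 (a ∧ b) + 𝟙 (a ∧ c) + 𝟙 (b ∧ c))
inclusion-exclusion₃ false = inclusion-exclusion₂
inclusion-exclusion₃ true b c = s≤s (m≤m+n _ _)

inclusion-exclusion₄ : ∀ a b c d → 𝟙 a + 𝟙 b + 𝟙 c + 𝟙 d ≤
  1 + (𝟙 (a ∧ b) + 𝟙 (a ∧ c) + 𝟙 (a ∧ d) + 𝟙 (b ∧ c) + 𝟙 (b ∧ d) + 𝟙 (c ∧ d))
inclusion-exclusion₄ false = inclusion-exclusion₃
inclusion-exclusion₄ true b c d = s≤s (≤-trans (m≤m+n _ _) (≤-trans (m≤m+n _ _) (m≤m+n _ _)))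

∧-pair : ∀ d a b → 𝟙 (d ∧ a) + 𝟙 (d ∧ b) ≤ 𝟙 d + 𝟙 (a ∧ b)
∧-pair false a b = z≤n
∧-pair true a b = inclusion-exclusion₂ a b

∧-triple : ∀ d a b c → a ∧ b ∧ c ≡ false → 𝟙 (d ∧ a) + 𝟙 (d ∧ b) + 𝟙 (d ∧ c) ≤ 𝟙 d + 𝟙 d
∧-triple false a b c _ = z≤n
∧-triple true false b c _ = +-mono-≤ (𝟙≤1 b) (𝟙≤1 c)
∧-triple true true false c _ = s≤s (𝟙≤1 c)
∧-triple true true true false _ = ≤-refl

bipartite₃ : ∀ a b c → 𝟙 (a xor b) + 𝟙 (a xor c) + 𝟙 (b xor c) ≤ 2
bipartite₃ true true true = decide-≤
bipartite₃ true true false = decide-≤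
bipartite₃ true false true = decide-≤
bipartite₃ true false false = decide-≤
bipartite₃ false true true = decide-≤
bipartite₃ false true false = decide-≤
bipartite₃ false false true = decide-≤
bipartite₃ false false false = decide-≤

bipartite₄ : ∀ a b c d →
  𝟙 (a xor b) + 𝟙 (a xor c) + 𝟙 (a xor d) + 𝟙 (b xor c) + 𝟙 (b xor d) + 𝟙 (c xor d) ≤ 4
bipartite₄ true true true true = decide-≤
bipartite₄ true true true false = decide-≤
bipartite₄ true true false true = decide-≤
bipartite₄ true true false false = decide-≤
bipartite₄ true false true true = decide-≤
bipartite₄ true false true false = decide-≤
bipartite₄ true false false true = decide-≤
bipartite₄ true false false false = decide-≤
bipartite₄ false true true true = decide-≤
bipartite₄ false true true false = decide-≤
bipartite₄ false true false true = decide-≤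
bipartite₄ false true false false = decide-≤
bipartite₄ false false true true = decide-≤
bipartite₄ false false true false = decide-≤
bipartite₄ false false false true = decide-≤
bipartite₄ false false false false = decide-≤

sum-mono-≤ : ∀ {n} {f g : Fin n → ℕ} → (∀ i → f i ≤ g i) → sum f ≤ sum g
sum-mono-≤ {zero} f≤g = z≤n
sum-mono-≤ {suc n} f≤g = +-mono-≤ (f≤g zero) (sum-mono-≤ (f≤g ∘ suc))

sum-const : ∀ n c → sum {n} (λ _ → c) ≡ n * c
sum-const zero c = refl
sum-const (suc n) c = cong (c +_) (sum-const n c)

sum-≤-* : ∀ {n} {f : Fin n → ℕ} c → (∀ i → f i ≤ c) → sum f ≤ n * c
sum-≤-* {n} c f≤c = subst (_ ≤_) (sum-const n c) (sum-mono-≤ f≤c)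

≤-sum : ∀ {n} (f : Fin n → ℕ) i → f i ≤ sum f
≤-sum f zero = m≤m+n (f zero) _
≤-sum f (suc i) = ≤-trans (≤-sum (f ∘ suc) i) (m≤n+m _ (f zero))

≤-sum-removeAt : ∀ {n} (f : Fin (suc n) → ℕ) {i j} → j ≢ i → f j ≤ sum (f ∘ punchIn i)
≤-sum-removeAt f {i} {j} j≢i =
  subst (λ l → f l ≤ _) (punchIn-punchOut (j≢i ∘ sym)) (≤-sum (f ∘ punchIn i) (punchOut (j≢i ∘ sym)))

+-≤-sum : ∀ {n} (f : Fin n → ℕ) {i j} → i ≢ j → f i + f j ≤ sum f
+-≤-sum {suc n} f {i} {j} i≢j = subst (f i + f j ≤_) (sym (sum-remove {i = i} f)) (+-monoʳ-≤ (f i) (≤-sum-removeAt f (i≢j ∘ sym)))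

sum-≥1 : ∀ {n} (f : Fin n → ℕ) → 1 ≤ sum f → Σ (Fin n) λ i → 1 ≤ f i
sum-≥1 {suc n} f p with f zero in eq
... | suc _ = zero , subst (1 ≤_) (sym eq) (s≤s z≤n)
... | zero with sum-≥1 (f ∘ suc) p
... | i , q = suc i , q

sum-≥2 : ∀ {n} (f : Fin n → ℕ) → 2 ≤ sum f →
  (Σ (Fin n) λ i → 2 ≤ f i) ⊎ (Σ (Fin n) λ i → Σ (Fin n) λ j → i ≢ j × 1 ≤ f i × 1 ≤ f j)
sum-≥2 {suc n} f p with f zero in eq
... | suc (suc _) = inj₁ (zero , subst (2 ≤_) (sym eq) (s≤s (s≤s z≤n)))
... | suc zero with sum-≥1 (f ∘ suc) (≤-pred p)
...   | j , q = inj₂ (zero , suc j , (λ ()) , subst (1 ≤_) (sym eq) (s≤s z≤n) , q)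
sum-≥2 {suc n} f p | zero with sum-≥2 (f ∘ suc) p
... | inj₁ (i , q) = inj₁ (suc i , q)
... | inj₂ (i , j , i≢j , q , q') = inj₂ (suc i , suc j , i≢j ∘ suc-injective , q , q')

sum-𝟙-≤1 : ∀ {n} (b : Fin n → Bool) → (∀ i j → b i ≡ true → b j ≡ true → i ≡ j) → sum (𝟙 ∘ b) ≤ 1
sum-𝟙-≤1 {zero} b unique = z≤n
sum-𝟙-≤1 {suc n} b unique with b zero in eq
... | false = sum-𝟙-≤1 (b ∘ suc) λ i j p q → suc-injective (unique (suc i) (suc j) p q)
... | true = s≤s (≤-reflexive (sum-𝟙-zero (b ∘ suc) λ i p → contradiction (unique zero (suc i) eq p) λ ()))
  where
  sum-𝟙-zero : ∀ {m} (c : Fin m → Bool) → (∀ i → c i ≢ true) → sum (𝟙 ∘ c) ≡ 0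
  sum-𝟙-zero {zero} c none = refl
  sum-𝟙-zero {suc m} c none with c zero in eq
  ... | true = contradiction eq (none zero)
  ... | false = sum-𝟙-zero (c ∘ suc) (none ∘ suc)

sum-𝟙-∧-≤ : ∀ {n} (c : Fin n → Bool) b → sum (𝟙 ∘ c) ≤ 1 → sum (λ i → 𝟙 (c i ∧ b)) ≤ 𝟙 b
sum-𝟙-∧-≤ c true ≤1 = ≤-trans (sum-mono-≤ λ i → ≤-reflexive (cong 𝟙 (∧-identityʳ (c i)))) ≤1
sum-𝟙-∧-≤ {n} c false _ = ≤-trans (sum-mono-≤ λ i → ≤-reflexive (cong 𝟙 (∧-zeroʳ (c i))))
  (≤-reflexive (trans (sum-const n 0) (*-zeroʳ n)))

∑ₗ : {A : Set} → List A → (A → ℕ) → ℕ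
∑ₗ [] f = 0
∑ₗ (x ∷ xs) f = f x + ∑ₗ xs f

syntax ∑ₗ xs (λ e → t) = ∑[ e ∈ xs ] t

module _ {A : Set} where

  ∑ₗ-distrib-+ : ∀ (xs : List A) (f g : A → ℕ) → ∑[ e ∈ xs ] (f e + g e) ≡ ∑ₗ xs f + ∑ₗ xs g
  ∑ₗ-distrib-+ [] f g = refl
  ∑ₗ-distrib-+ (x ∷ xs) f g rewrite ∑ₗ-distrib-+ xs f g = interchange (f x) (g x) (∑ₗ xs f) (∑ₗ xs g)
    where
    interchange : ∀ a b c d → a + b + (c + d) ≡ a + c + (b + d)
    interchange = solve-∀

  ∑ₗ-monoᴬ : ∀ {P : A → Set} {f g : A → ℕ} {xs} → All P xs → (∀ e → P e → f e ≤ g e) → ∑ₗ xs f ≤ ∑ₗ xs g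
  ∑ₗ-monoᴬ [] f≤g = z≤n
  ∑ₗ-monoᴬ (px ∷ pxs) f≤g = +-mono-≤ (f≤g _ px) (∑ₗ-monoᴬ pxs f≤g)

  ∑ₗ-mono : ∀ {f g : A → ℕ} xs → (∀ e → f e ≤ g e) → ∑ₗ xs f ≤ ∑ₗ xs g
  ∑ₗ-mono [] f≤g = z≤n
  ∑ₗ-mono (x ∷ xs) f≤g = +-mono-≤ (f≤g x) (∑ₗ-mono xs f≤g)

  ∑ₗ-const : ∀ (xs : List A) c → ∑[ e ∈ xs ] c ≡ length xs * c
  ∑ₗ-const [] c = refl
  ∑ₗ-const (x ∷ xs) c = cong (c +_) (∑ₗ-const xs c)

  sum-∑ₗ-comm : ∀ {n} (g : Fin n → A → ℕ) (xs : List A) → sum (λ i → ∑ₗ xs (g i)) ≡ ∑[ e ∈ xs ] sum (λ i → g i e)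
  sum-∑ₗ-comm {zero} g xs = sym (trans (∑ₗ-const xs 0) (*-zeroʳ (length xs)))
  sum-∑ₗ-comm {suc n} g xs = trans (cong (∑ₗ xs (g zero) +_) (sum-∑ₗ-comm (g ∘ suc) xs))
    (sym (∑ₗ-distrib-+ xs (g zero) (λ e → sum (λ i → g (suc i) e))))

  ∑ₗ-congᴬ : ∀ {P : A → Set} {f g : A → ℕ} {xs} → All P xs → (∀ e → P e → f e ≡ g e) → ∑ₗ xs f ≡ ∑ₗ xs g
  ∑ₗ-congᴬ [] f≡g = refl
  ∑ₗ-congᴬ (px ∷ pxs) f≡g = cong₂ _+_ (f≡g _ px) (∑ₗ-congᴬ pxs f≡g)

AllPairs-∈ : ∀ {A : Set} {R : A → A → Set} {L a b} → AllPairs R L → a ∈ L → b ∈ L → a ≡ b ⊎ R a b ⊎ R b a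
AllPairs-∈ (_ ∷ _) (here refl) (here refl) = inj₁ refl
AllPairs-∈ (Ra ∷ _) (here refl) (there b∈) = inj₂ (inj₁ (All.lookup Ra b∈))
AllPairs-∈ (Ra ∷ _) (there a∈) (here refl) = inj₂ (inj₂ (All.lookup Ra a∈))
AllPairs-∈ (_ ∷ pairs) (there a∈) (there b∈) = AllPairs-∈ pairs a∈ b∈

∉⇒≢ : ∀ {A : Set} {L : List A} {x z : A} → z ∉ L → x ∈ L → x ≢ z
∉⇒≢ z∉L x∈L refl = z∉L x∈L

-- Counting faults

module Faults {k : ℕ} (F : List (Edge (suc k))) (F-edges : IsEdgeSet F) where

  V : Set
  V = Vertex (suc k)

  _≟ᵥ_ : (x y : V) → Dec (x ≡ y)
  _≟ᵥ_ = ≡-dec _≟ᶠ_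

  sameEdge? : (e e' : Edge (suc k)) → Dec (SameEdge e e')
  sameEdge? (u , v) (u' , v') = ((u ≟ᵥ u') ×-dec (v ≟ᵥ v')) ⊎-dec ((u ≟ᵥ v') ×-dec (v ≟ᵥ u'))

  SameEdge-sym : ∀ {e e' : Edge (suc k)} → SameEdge e e' → SameEdge e' e
  SameEdge-sym (inj₁ (refl , refl)) = inj₁ (refl , refl)
  SameEdge-sym (inj₂ (refl , refl)) = inj₂ (refl , refl)

  SameEdge-trans : ∀ {e e' e'' : Edge (suc k)} → SameEdge e e' → SameEdge e' e'' → SameEdge e e''
  SameEdge-trans (inj₁ (refl , refl)) q = q
  SameEdge-trans (inj₂ (refl , refl)) (inj₁ (refl , refl)) = inj₂ (refl , refl)
  SameEdge-trans (inj₂ (refl , refl)) (inj₂ (refl , refl)) = inj₁ (refl , refl)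

  InF? : (u v : V) → Dec (InF F u v)
  InF? u v = any? (sameEdge? (u , v)) F

  Incident : V → Edge (suc k) → Set
  Incident x e = proj₁ e ≡ x ⊎ proj₂ e ≡ x

  incident? : ∀ x e → Dec (Incident x e)
  incident? x e = (proj₁ e ≟ᵥ x) ⊎-dec (proj₂ e ≟ᵥ x)

  Dim? : ∀ m (x y : V) → Dec (Dim m x y)
  Dim? zero (a ∷ u) (b ∷ v) = ≡-dec _≟ᶠ_ u v
  Dim? (suc i) (a ∷ u) (b ∷ v) =
    ¬? (lookup u i ≟ᶠ lookup v i) ×-dec Finₚ.all? (λ j → ¬? (j ≟ᶠ i) →-dec (lookup u j ≟ᶠ lookup v j))

  DimE : Fin (suc k) → Edge (suc k) → Set
  DimE m e = Dim m (proj₁ e) (proj₂ e)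

  F-adj : All (λ e → Adj (proj₁ e) (proj₂ e)) F
  F-adj = proj₁ F-edges

  F-distinct : AllPairs (λ e e' → ¬ SameEdge e e') F
  F-distinct = proj₂ F-edges

  inc : V → Edge (suc k) → Bool
  inc x e = does (incident? x e)

  inDim : Fin (suc k) → Edge (suc k) → Bool
  inDim m e = does (Dim? m (proj₁ e) (proj₂ e))

  faulty : V → Fin (suc k) → Bool → Bool
  faulty x m s = does (InF? x (neighbour x m s))

  faultsAt : V → ℕ
  faultsAt x = ∑[ e ∈ F ] 𝟙 (inc x e)

  faultsAtIn : V → Fin (suc k) → ℕ
  faultsAtIn x m = ∑[ e ∈ F ] 𝟙 (inDim m e ∧ inc x e)

  dimFaults : Fin (suc k) → ℕ
  dimFaults m = ∑[ e ∈ F ] 𝟙 (inDim m e)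

  faultsBetween : V → V → ℕ
  faultsBetween x y = ∑[ e ∈ F ] 𝟙 (inc x e ∧ inc y e)

  free : V → Fin (suc k) → ℕ
  free x m = 𝟙 (not (faulty x m true)) + 𝟙 (not (faulty x m false))

  deg : V → ℕ
  deg x = sum (free x)

  -- The degree of x in BH_n − ∂D_m − F: punchIn m skips dimension m.
  degWithout : Fin (suc k) → V → ℕ
  degWithout m x = sum (free x ∘ punchIn m)

  count-sameEdge : ∀ e₀ {xs} → AllPairs (λ e e' → ¬ SameEdge e e') xs →
    ∑[ e ∈ xs ] 𝟙 (does (sameEdge? e₀ e)) ≡ 𝟙 (does (any? (sameEdge? e₀) xs))
  count-sameEdge e₀ [] = refl
  count-sameEdge e₀ {x ∷ xs} (x-new ∷ distinct) = head-case (sameEdge? e₀ x)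
    where
    none : ∀ {ys} → SameEdge e₀ x → All (λ e → ¬ SameEdge x e) ys → ∑[ e ∈ ys ] 𝟙 (does (sameEdge? e₀ e)) ≡ 0
    none e₀~x [] = refl
    none {y ∷ _} e₀~x (x≁y ∷ rest)
      rewrite dec-false (sameEdge? e₀ y) (x≁y ∘ SameEdge-trans (SameEdge-sym e₀~x)) = none e₀~x rest
    head-case : (d : Dec (SameEdge e₀ x)) →
      𝟙 (does d) + ∑[ e ∈ xs ] 𝟙 (does (sameEdge? e₀ e)) ≡ 𝟙 (does d ∨ does (any? (sameEdge? e₀) xs))
    head-case (no _) = count-sameEdge e₀ distinct
    head-case (yes e₀~x) = cong suc (none e₀~x x-new)

  sameEdge⇒incident : ∀ {x y} e → SameEdge (x , y) e → Incident x e
  sameEdge⇒incident e (inj₁ (refl , refl)) = inj₁ refl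
  sameEdge⇒incident e (inj₂ (refl , refl)) = inj₂ refl

  sameEdge⇒dim : ∀ x m s e → SameEdge (x , neighbour x m s) e → DimE m e
  sameEdge⇒dim x m s e (inj₁ (refl , refl)) = neighbour-dim x m s
  sameEdge⇒dim x m s e (inj₂ (refl , refl)) = neighbour-dimʳ x m s

  incident-dim⇒sameEdge : ∀ x m e → Adj (proj₁ e) (proj₂ e) → Incident x e → DimE m e →
    Σ Bool λ s → SameEdge (x , neighbour x m s) e
  incident-dim⇒sameEdge x m (.x , y) xy (inj₁ refl) dim with adj⇒neighbour x y xy
  ... | m' , s , refl with dim-unique x _ dim (neighbour-dim x m' s)
  ... | refl = s , inj₁ (refl , refl)
  incident-dim⇒sameEdge x m (y , .x) yx (inj₂ refl) dim with adj⇒neighbour x y (adj-sym y x yx)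
  ... | m' , s , refl with dim-unique x _ (dim-sym _ x dim) (neighbour-dim x m' s)
  ... | refl = s , inj₂ (refl , refl)

  incident-dim-count : ∀ x m e → Adj (proj₁ e) (proj₂ e) →
    𝟙 (inDim m e ∧ inc x e) ≡
    𝟙 (does (sameEdge? (x , neighbour x m true) e)) + 𝟙 (does (sameEdge? (x , neighbour x m false) e))
  incident-dim-count x m e adj = split (sameEdge? (x , neighbour x m true) e) (sameEdge? (x , neighbour x m false) e)
    where
    neither : ¬ SameEdge (x , neighbour x m true) e → ¬ SameEdge (x , neighbour x m false) e → ¬ (DimE m e × Incident x e)
    neither ≁t ≁f (d , i) with incident-dim⇒sameEdge x m e adj i d
    ... | true , ~t = ≁t ~t
    ... | false , ~f = ≁f ~f
    split : (t : Dec (SameEdge (x , neighbour x m true) e)) (f : Dec (SameEdge (x , neighbour x m false) e)) →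
      𝟙 (inDim m e ∧ inc x e) ≡ 𝟙 (does t) + 𝟙 (does f)
    split (yes ~t) (yes ~f) = contradiction (SameEdge-trans ~t (SameEdge-sym ~f)) distinct
      where
      distinct : ¬ SameEdge (x , neighbour x m true) (x , neighbour x m false)
      distinct (inj₁ (_ , eq)) with () ← proj₂ (neighbour-injective x eq)
      distinct (inj₂ (eq , _)) = neighbour≢self x m false (sym eq)
    split (yes ~t) (no _)
      rewrite dec-true (Dim? m _ _ ×-dec incident? x e) (sameEdge⇒dim x m true e ~t , sameEdge⇒incident e ~t) = refl
    split (no _) (yes ~f)
      rewrite dec-true (Dim? m _ _ ×-dec incident? x e) (sameEdge⇒dim x m false e ~f , sameEdge⇒incident e ~f) = refl
    split (no ≁t) (no ≁f) rewrite dec-false (Dim? m _ _ ×-dec incident? x e) (neither ≁t ≁f) = refl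

  faultsAtIn≡faulty : ∀ x m → faultsAtIn x m ≡ 𝟙 (faulty x m true) + 𝟙 (faulty x m false)
  faultsAtIn≡faulty x m = begin
    faultsAtIn x m
      ≡⟨ ∑ₗ-congᴬ F-adj (incident-dim-count x m) ⟩
    ∑[ e ∈ F ] (𝟙 (does (sameEdge? (x , neighbour x m true) e)) + 𝟙 (does (sameEdge? (x , neighbour x m false) e)))
      ≡⟨ ∑ₗ-distrib-+ F _ _ ⟩
    ∑[ e ∈ F ] 𝟙 (does (sameEdge? (x , neighbour x m true) e)) + ∑[ e ∈ F ] 𝟙 (does (sameEdge? (x , neighbour x m false) e))
      ≡⟨ cong₂ _+_ (count-sameEdge _ F-distinct) (count-sameEdge _ F-distinct) ⟩
    𝟙 (faulty x m true) + 𝟙 (faulty x m false) ∎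
    where open ≡-Reasoning

  free-+-faultsAtIn : ∀ x m → free x m + faultsAtIn x m ≡ 2
  free-+-faultsAtIn x m rewrite faultsAtIn≡faulty x m = complement (faulty x m true) (faulty x m false)
    where
    complement : ∀ a b → 𝟙 (not a) + 𝟙 (not b) + (𝟙 a + 𝟙 b) ≡ 2
    complement false false = refl
    complement false true = refl
    complement true false = refl
    complement true true = refl

  free≤1⇒1≤faultsAtIn : ∀ {x m} → free x m ≤ 1 → 1 ≤ faultsAtIn x m
  free≤1⇒1≤faultsAtIn {x} {m} f≤1 =
    +-cancelˡ-≤ 1 1 _ (subst (_≤ 1 + faultsAtIn x m) (free-+-faultsAtIn x m) (+-monoˡ-≤ _ f≤1))

  free≤2 : ∀ x m → free x m ≤ 2
  free≤2 x m = +-mono-≤ (𝟙≤1 (not (faulty x m true))) (𝟙≤1 (not (faulty x m false)))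

  1≤free⇒faultFree : ∀ x m → 1 ≤ free x m → Σ Bool λ s → ¬ InF F x (neighbour x m s)
  1≤free⇒faultFree x m p = pick (faulty x m true) (faulty x m false) refl refl p
    where
    pick : ∀ a b → faulty x m true ≡ a → faulty x m false ≡ b → 1 ≤ 𝟙 (not a) + 𝟙 (not b) →
      Σ Bool λ s → ¬ InF F x (neighbour x m s)
    pick false _ eq _ _ = true , does-false (InF? x _) eq
    pick true false _ eq _ = false , does-false (InF? x _) eq
    pick true true _ _ ()

  2≤free⇒faultFree : ∀ x m → 2 ≤ free x m → ∀ s → ¬ InF F x (neighbour x m s)
  2≤free⇒faultFree x m p = both (faulty x m true) (faulty x m false) refl refl p
    where
    both : ∀ a b → faulty x m true ≡ a → faulty x m false ≡ b → 2 ≤ 𝟙 (not a) + 𝟙 (not b) →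
      ∀ s → ¬ InF F x (neighbour x m s)
    both false false eq _ _ true = does-false (InF? x _) eq
    both false false _ eq _ false = does-false (InF? x _) eq
    both false true _ _ (s≤s ())
    both true false _ _ (s≤s ())
    both true true _ _ ()

  faultFree⇒1≤free : ∀ x m s → ¬ InF F x (neighbour x m s) → 1 ≤ free x m
  faultFree⇒1≤free x m true nf rewrite dec-false (InF? x (neighbour x m true)) nf = s≤s z≤n
  faultFree⇒1≤free x m false nf rewrite dec-false (InF? x (neighbour x m false)) nf = m≤n+m 1 _

  faultFree²⇒2≤free : ∀ x m → (∀ s → ¬ InF F x (neighbour x m s)) → 2 ≤ free x m
  faultFree²⇒2≤free x m nf
    rewrite dec-false (InF? x (neighbour x m true)) (nf true) | dec-false (InF? x (neighbour x m false)) (nf false)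
    = s≤s (s≤s z≤n)

  deg-split : ∀ x m → deg x ≡ free x m + degWithout m x
  deg-split x m = sum-remove {i = m} (free x)

  neighbour-avoiding : ∀ x {m m'} s → m' ≢ m → ¬ InF F x (neighbour x m' s) → Nbr F (Dim m) x (neighbour x m' s)
  neighbour-avoiding x {m} {m'} s m'≢m nf =
    neighbour-adj x m' s , nf , λ dim → m'≢m (dim-unique x _ (neighbour-dim x m' s) dim)

  1≤degWithout⇒Deg≥1 : ∀ m x → 1 ≤ degWithout m x → Deg≥1 F (Dim m) x
  1≤degWithout⇒Deg≥1 m x p with sum-≥1 (free x ∘ punchIn m) p
  ... | j , q with 1≤free⇒faultFree x _ q
  ... | s , nf = neighbour x (punchIn m j) s , neighbour-avoiding x s (punchInᵢ≢i m j) nf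

  2≤degWithout⇒Deg≥2 : ∀ m x → 2 ≤ degWithout m x → Deg≥2 F (Dim m) x
  2≤degWithout⇒Deg≥2 m x p with sum-≥2 (free x ∘ punchIn m) p
  ... | inj₁ (j , q) =
    neighbour x m' true , neighbour x m' false , (λ eq → true≢false (proj₂ (neighbour-injective x eq))) ,
    neighbour-avoiding x true (punchInᵢ≢i m j) (2≤free⇒faultFree x m' q true) ,
    neighbour-avoiding x false (punchInᵢ≢i m j) (2≤free⇒faultFree x m' q false)
    where
    m' : Fin (suc k)
    m' = punchIn m j
    true≢false : true ≢ false
    true≢false ()
  ... | inj₂ (i , j , i≢j , q , q') with 1≤free⇒faultFree x _ q | 1≤free⇒faultFree x _ q'
  ... | s , nf | s' , nf' =
    neighbour x (punchIn m i) s , neighbour x (punchIn m j) s' ,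
    (λ eq → i≢j (punchIn-injective m i j (proj₁ (neighbour-injective x eq)))) ,
    neighbour-avoiding x s (punchInᵢ≢i m i) nf , neighbour-avoiding x s' (punchInᵢ≢i m j) nf'

  Deg≥2⇒2≤deg : ∀ x → Deg≥2 F NoEdges x → 2 ≤ deg x
  Deg≥2⇒2≤deg x (v , w , v≢w , (xv , nv , _) , (xw , nw , _))
    with adj⇒neighbour x v xv | adj⇒neighbour x w xw
  ... | m , s , refl | m' , s' , refl with m ≟ᶠ m'
  ...   | no m≢m' = ≤-trans (+-mono-≤ (faultFree⇒1≤free x m s nv) (faultFree⇒1≤free x m' s' nw)) (+-≤-sum (free x) m≢m')
  ...   | yes refl = ≤-trans (faultFree²⇒2≤free x m (both s s' v≢w nv nw)) (≤-sum (free x) m)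
    where
    both : ∀ t t' → neighbour x m t ≢ neighbour x m t' →
      ¬ InF F x (neighbour x m t) → ¬ InF F x (neighbour x m t') → ∀ u → ¬ InF F x (neighbour x m u)
    both true true ne _ _ _ = contradiction refl ne
    both false false ne _ _ _ = contradiction refl ne
    both true false _ nt nf true = nt
    both true false _ nt nf false = nf
    both false true _ nf nt true = nt
    both false true _ nf nt false = nf

  faultsAtIn≤dimFaults : ∀ x m → faultsAtIn x m ≤ dimFaults m
  faultsAtIn≤dimFaults x m = ∑ₗ-mono F λ e → 𝟙-does-mono proj₁ (Dim? m _ _ ×-dec incident? x e) (Dim? m _ _)

  faultsAtIn-pair : ∀ x y m → faultsAtIn x m + faultsAtIn y m ≤ dimFaults m + faultsBetween x y
  faultsAtIn-pair x y m = begin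
    faultsAtIn x m + faultsAtIn y m                          ≡⟨ ∑ₗ-distrib-+ F _ _ ⟨
    ∑[ e ∈ F ] (𝟙 (inDim m e ∧ inc x e) + 𝟙 (inDim m e ∧ inc y e)) ≤⟨ ∑ₗ-mono F (λ e → ∧-pair (inDim m e) (inc x e) (inc y e)) ⟩
    ∑[ e ∈ F ] (𝟙 (inDim m e) + 𝟙 (inc x e ∧ inc y e))        ≡⟨ ∑ₗ-distrib-+ F _ _ ⟩
    dimFaults m + faultsBetween x y ∎
    where open ≤-Reasoning

  incident³-impossible : ∀ {x y z} e → x ≢ y → x ≢ z → y ≢ z → ¬ (Incident x e × Incident y e × Incident z e)
  incident³-impossible e x≢y x≢z y≢z (inj₁ refl , inj₁ refl , _) = x≢y refl
  incident³-impossible e x≢y x≢z y≢z (inj₂ refl , inj₂ refl , _) = x≢y refl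
  incident³-impossible e x≢y x≢z y≢z (inj₁ refl , inj₂ refl , inj₁ refl) = x≢z refl
  incident³-impossible e x≢y x≢z y≢z (inj₁ refl , inj₂ refl , inj₂ refl) = y≢z refl
  incident³-impossible e x≢y x≢z y≢z (inj₂ refl , inj₁ refl , inj₁ refl) = y≢z refl
  incident³-impossible e x≢y x≢z y≢z (inj₂ refl , inj₁ refl , inj₂ refl) = x≢z refl

  faultsAtIn-triple : ∀ {x y z} m → x ≢ y → x ≢ z → y ≢ z →
    faultsAtIn x m + faultsAtIn y m + faultsAtIn z m ≤ dimFaults m + dimFaults m
  faultsAtIn-triple {x} {y} {z} m x≢y x≢z y≢z = begin
    faultsAtIn x m + faultsAtIn y m + faultsAtIn z m
      ≡⟨ trans (∑ₗ-distrib-+ F _ _) (cong (_+ faultsAtIn z m) (∑ₗ-distrib-+ F _ _)) ⟨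
    ∑[ e ∈ F ] (𝟙 (inDim m e ∧ inc x e) + 𝟙 (inDim m e ∧ inc y e) + 𝟙 (inDim m e ∧ inc z e))
      ≤⟨ ∑ₗ-mono F (λ e → ∧-triple (inDim m e) (inc x e) (inc y e) (inc z e)
           (dec-false (incident? x e ×-dec incident? y e ×-dec incident? z e) (incident³-impossible e x≢y x≢z y≢z))) ⟩
    ∑[ e ∈ F ] (𝟙 (inDim m e) + 𝟙 (inDim m e))
      ≡⟨ ∑ₗ-distrib-+ F _ _ ⟩
    dimFaults m + dimFaults m ∎
    where open ≤-Reasoning

  incident²⇒sameEdge : ∀ {x y} e → x ≢ y → Incident x e → Incident y e → SameEdge (x , y) e
  incident²⇒sameEdge e x≢y (inj₁ refl) (inj₁ refl) = contradiction refl x≢y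
  incident²⇒sameEdge e x≢y (inj₁ refl) (inj₂ refl) = inj₁ (refl , refl)
  incident²⇒sameEdge e x≢y (inj₂ refl) (inj₁ refl) = inj₂ (refl , refl)
  incident²⇒sameEdge e x≢y (inj₂ refl) (inj₂ refl) = contradiction refl x≢y

  faultsBetween≤1 : ∀ {x y} → x ≢ y → faultsBetween x y ≤ 1
  faultsBetween≤1 {x} {y} x≢y = begin
    faultsBetween x y
      ≤⟨ ∑ₗ-mono F (λ e → 𝟙-does-mono (λ (i , j) → incident²⇒sameEdge e x≢y i j)
                                         (incident? x e ×-dec incident? y e) (sameEdge? (x , y) e)) ⟩
    ∑[ e ∈ F ] 𝟙 (does (sameEdge? (x , y) e)) ≡⟨ count-sameEdge (x , y) F-distinct ⟩
    𝟙 (does (InF? x y))                       ≤⟨ 𝟙≤1 _ ⟩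
    1 ∎
    where open ≤-Reasoning

  faultsBetween-sameParity : ∀ {x y} → x ≢ y → parity x ≡ parity y → faultsBetween x y ≡ 0
  faultsBetween-sameParity {x} {y} x≢y same = begin
    faultsBetween x y         ≡⟨ ∑ₗ-congᴬ F-adj (λ e adj → cong 𝟙 (dec-false (incident? x e ×-dec incident? y e) (unjoined e adj))) ⟩
    ∑[ e ∈ F ] 0              ≡⟨ ∑ₗ-const F 0 ⟩
    length F * 0              ≡⟨ *-zeroʳ (length F) ⟩
    0 ∎
    where
    open ≡-Reasoning
    unjoined : ∀ e → Adj (proj₁ e) (proj₂ e) → ¬ (Incident x e × Incident y e)
    unjoined e adj (i , j) with incident²⇒sameEdge e x≢y i j
    ... | inj₁ (refl , refl) = adj⇒parity≢ x y adj same
    ... | inj₂ (refl , refl) = adj⇒parity≢ y x adj (sym same)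

  faultsBetween≤xor : ∀ {x y} → x ≢ y → faultsBetween x y ≤ 𝟙 (parity x xor parity y)
  faultsBetween≤xor {x} {y} x≢y with parity x in px | parity y in py
  ... | true | true = ≤-reflexive (faultsBetween-sameParity x≢y (trans px (sym py)))
  ... | false | false = ≤-reflexive (faultsBetween-sameParity x≢y (trans px (sym py)))
  ... | true | false = faultsBetween≤1 x≢y
  ... | false | true = faultsBetween≤1 x≢y

  one-dimension : ∀ e → sum (λ m → 𝟙 (inDim m e)) ≤ 1
  one-dimension e = sum-𝟙-≤1 (λ m → inDim m e)
    λ m m' p q → dim-unique (proj₁ e) (proj₂ e) (does-true (Dim? m _ _) p) (does-true (Dim? m' _ _) q)

  sum-faultsAtIn≤faultsAt : ∀ x → sum (faultsAtIn x) ≤ faultsAt x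
  sum-faultsAtIn≤faultsAt x = begin
    sum (faultsAtIn x)                                ≡⟨ sum-∑ₗ-comm (λ m e → 𝟙 (inDim m e ∧ inc x e)) F ⟩
    ∑[ e ∈ F ] sum (λ m → 𝟙 (inDim m e ∧ inc x e))    ≤⟨ ∑ₗ-mono F (λ e → sum-𝟙-∧-≤ (λ m → inDim m e) (inc x e) (one-dimension e)) ⟩
    faultsAt x ∎
    where open ≤-Reasoning

  length≤sum-dimFaults : length F ≤ sum dimFaults
  length≤sum-dimFaults = begin
    length F                                 ≡⟨ trans (∑ₗ-const F 1) (*-identityʳ (length F)) ⟨
    ∑[ e ∈ F ] 1                             ≤⟨ ∑ₗ-monoᴬ F-adj has-dimension ⟩
    ∑[ e ∈ F ] sum (λ m → 𝟙 (inDim m e))     ≡⟨ sum-∑ₗ-comm (λ m e → 𝟙 (inDim m e)) F ⟨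
    sum dimFaults ∎
    where
    open ≤-Reasoning
    has-dimension : ∀ e → Adj (proj₁ e) (proj₂ e) → 1 ≤ sum (λ m → 𝟙 (inDim m e))
    has-dimension (x , y) adj with adj⇒neighbour x y adj
    ... | m , s , refl = ≤-trans (≤-reflexive (cong 𝟙 (sym (dec-true (Dim? m x _) (neighbour-dim x m s)))))
                                 (≤-sum (λ m' → 𝟙 (inDim m' (x , neighbour x m s))) m)

  faultsAt-triple : ∀ x y z →
    faultsAt x + faultsAt y + faultsAt z ≤ length F + (faultsBetween x y + faultsBetween x z + faultsBetween y z)
  faultsAt-triple x y z = begin
    faultsAt x + faultsAt y + faultsAt z
      ≡⟨ trans (∑ₗ-distrib-+ F _ _) (cong (_+ faultsAt z) (∑ₗ-distrib-+ F _ _)) ⟨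
    ∑[ e ∈ F ] (𝟙 (inc x e) + 𝟙 (inc y e) + 𝟙 (inc z e))
      ≤⟨ ∑ₗ-mono F (λ e → inclusion-exclusion₃ (inc x e) (inc y e) (inc z e)) ⟩
    ∑[ e ∈ F ] (1 + (𝟙 (inc x e ∧ inc y e) + 𝟙 (inc x e ∧ inc z e) + 𝟙 (inc y e ∧ inc z e)))
      ≡⟨ trans (∑ₗ-distrib-+ F _ _) (cong₂ _+_ (trans (∑ₗ-const F 1) (*-identityʳ (length F)))
           (trans (∑ₗ-distrib-+ F _ _) (cong (_+ faultsBetween y z) (∑ₗ-distrib-+ F _ _)))) ⟩
    length F + (faultsBetween x y + faultsBetween x z + faultsBetween y z) ∎
    where open ≤-Reasoning

  faultsAt-quadruple : ∀ x y z w →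
    faultsAt x + faultsAt y + faultsAt z + faultsAt w ≤
    length F + (faultsBetween x y + faultsBetween x z + faultsBetween x w +
                faultsBetween y z + faultsBetween y w + faultsBetween z w)
  faultsAt-quadruple x y z w = begin
    faultsAt x + faultsAt y + faultsAt z + faultsAt w
      ≡⟨ trans (∑ₗ-distrib-+ F _ _) (cong (_+ faultsAt w) (trans (∑ₗ-distrib-+ F _ _)
           (cong (_+ faultsAt z) (∑ₗ-distrib-+ F _ _)))) ⟨
    ∑[ e ∈ F ] (𝟙 (inc x e) + 𝟙 (inc y e) + 𝟙 (inc z e) + 𝟙 (inc w e))
      ≤⟨ ∑ₗ-mono F (λ e → inclusion-exclusion₄ (inc x e) (inc y e) (inc z e) (inc w e)) ⟩
    ∑[ e ∈ F ] (1 + (𝟙 (inc x e ∧ inc y e) + 𝟙 (inc x e ∧ inc z e) + 𝟙 (inc x e ∧ inc w e) +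
                     𝟙 (inc y e ∧ inc z e) + 𝟙 (inc y e ∧ inc w e) + 𝟙 (inc z e ∧ inc w e)))
      ≡⟨ trans (∑ₗ-distrib-+ F _ _) (cong₂ _+_ (trans (∑ₗ-const F 1) (*-identityʳ (length F)))
           (trans (∑ₗ-distrib-+ F _ _) (cong (_+ faultsBetween z w) (trans (∑ₗ-distrib-+ F _ _)
           (cong (_+ faultsBetween y w) (trans (∑ₗ-distrib-+ F _ _) (cong (_+ faultsBetween y z)
           (trans (∑ₗ-distrib-+ F _ _) (cong (_+ faultsBetween x w) (∑ₗ-distrib-+ F _ _)))))))))) ⟩
    length F + (faultsBetween x y + faultsBetween x z + faultsBetween x w +
                faultsBetween y z + faultsBetween y w + faultsBetween z w) ∎
    where open ≤-Reasoning

  length-filter-dim : ∀ m xs → length (filter (λ e → Dim? m (proj₁ e) (proj₂ e)) xs) ≡ ∑[ e ∈ xs ] 𝟙 (inDim m e)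
  length-filter-dim m [] = refl
  length-filter-dim m (e ∷ xs) with does (Dim? m (proj₁ e) (proj₂ e))
  ... | true = cong suc (length-filter-dim m xs)
  ... | false = length-filter-dim m xs

  ≤dimFaults⇒DimCount≥ : ∀ m c → c ≤ dimFaults m → DimCount≥ F m c
  ≤dimFaults⇒DimCount≥ m c c≤ =
    filter Dim?ₘ F , filter-⊆ Dim?ₘ F , subst (c ≤_) (sym (length-filter-dim m F)) c≤ , all-filter Dim?ₘ F
    where
    Dim?ₘ : ∀ e → Dec (DimE m e)
    Dim?ₘ e = Dim? m (proj₁ e) (proj₂ e)

-- Arithmetic of the fault budget

module Budget {n L : ℕ} (3≤n : 3 ≤ n) (|F| : L + 5 ≡ 4 * n) where

  open ≤-Reasoning

  faults-exceed-2n : ∀ {s} → L ≤ s → s ≤ n * 2 → ⊥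
  faults-exceed-2n {s} L≤s s≤2n = ≤⇒≯ (+-cancelˡ-≤ (n * 2) _ _ 4n≤2n+5) (*-monoˡ-≤ 2 3≤n)
    where
    4n≤2n+5 : n * 2 + n * 2 ≤ n * 2 + 5
    4n≤2n+5 = begin
      n * 2 + n * 2 ≡⟨ solve (List ℕ ∋ n ∷ []) ⟩
      4 * n         ≡⟨ |F| ⟨
      L + 5         ≤⟨ +-monoˡ-≤ 5 (≤-trans L≤s s≤2n) ⟩
      n * 2 + 5     ∎

  no-four-lows-arith : ∀ {a b c d} → n * 2 ≤ a + 3 → n * 2 ≤ b + 3 → n * 2 ≤ c + 3 → n * 2 ≤ d + 3 →
    a + b + c + d ≤ L + 4 → ⊥
  no-four-lows-arith {a} {b} {c} {d} ha hb hc hd sum≤ =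
    ≤⇒≯ (+-cancelˡ-≤ (4 * n) _ _ 8n+5≤4n+16) (+-monoˡ-≤ 5 (*-monoʳ-≤ 4 3≤n))
    where
    8n+5≤4n+16 : 4 * n + (4 * n + 5) ≤ 4 * n + 16
    8n+5≤4n+16 = begin
      4 * n + (4 * n + 5)                      ≡⟨ solve (List ℕ ∋ n ∷ []) ⟩
      n * 2 + n * 2 + n * 2 + n * 2 + 5        ≤⟨ +-monoˡ-≤ 5 (+-mono-≤ (+-mono-≤ (+-mono-≤ ha hb) hc) hd) ⟩
      (a + 3) + (b + 3) + (c + 3) + (d + 3) + 5 ≡⟨ solve (List ℕ ∋ a ∷ b ∷ c ∷ d ∷ []) ⟩
      (a + b + c + d) + 17                     ≤⟨ +-monoˡ-≤ 17 sum≤ ⟩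
      L + 4 + 17                               ≡⟨ solve (List ℕ ∋ L ∷ []) ⟩
      L + 5 + 16                               ≡⟨ cong (_+ 16) |F| ⟩
      4 * n + 16                               ∎

  three-lows-arith : ∀ {a b c} → n * 2 ≤ b + 3 → n * 2 ≤ c + 3 → a + b + c ≤ L + 2 → a ≤ 3
  three-lows-arith {a} {b} {c} hb hc sum≤ = +-cancelˡ-≤ (4 * n + 5) _ _ a+4n+5≤3+4n+5
    where
    a+4n+5≤3+4n+5 : 4 * n + 5 + a ≤ 4 * n + 5 + 3
    a+4n+5≤3+4n+5 = begin
      4 * n + 5 + a                ≡⟨ solve (List ℕ ∋ n ∷ a ∷ []) ⟩
      a + (n * 2 + n * 2) + 5      ≤⟨ +-monoˡ-≤ 5 (+-monoʳ-≤ a (+-mono-≤ hb hc)) ⟩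
      a + ((b + 3) + (c + 3)) + 5  ≡⟨ solve (List ℕ ∋ a ∷ b ∷ c ∷ []) ⟩
      (a + b + c) + 11             ≤⟨ +-monoˡ-≤ 11 sum≤ ⟩
      L + 2 + 11                   ≡⟨ solve (List ℕ ∋ L ∷ []) ⟩
      L + 5 + 8                    ≡⟨ cong (_+ 8) |F| ⟩
      4 * n + 8                    ≡⟨ solve (List ℕ ∋ n ∷ []) ⟩
      4 * n + 5 + 3                ∎

  3≤complement : ∀ {t f} → t + f ≡ n * 2 → t ≤ 3 → 3 ≤ f
  3≤complement {t} {f} t+f≡2n t≤3 = +-cancelˡ-≤ t 3 f (begin
    t + 3   ≤⟨ +-monoˡ-≤ 3 t≤3 ⟩
    6       ≤⟨ *-monoˡ-≤ 2 3≤n ⟩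
    n * 2   ≡⟨ t+f≡2n ⟨
    t + f   ∎)

-- Case analysis on the low vertices

module Main (j : ℕ) (F : List (Edge (suc (suc (suc j))))) (F-edges : IsEdgeSet F)
  (|F|≡4n∸5 : length F ≡ 4 * suc (suc (suc j)) ∸ 5) (δ≥2 : MinDeg≥2 F NoEdges) where

  open Faults F F-edges
  open import Data.List.Membership.DecPropositional _≟ᵥ_ using (_∈?_)

  n : ℕ
  n = suc (suc (suc j))

  3≤n : 3 ≤ n
  3≤n = s≤s (s≤s (s≤s z≤n))

  |F|+5≡4n : length F + 5 ≡ 4 * n
  |F|+5≡4n = trans (cong (_+ 5) |F|≡4n∸5) (m∸n+n≡m {4 * n} {5} (≤-trans (m≤m+n 5 7) (*-monoʳ-≤ 4 3≤n)))

  open Budget 3≤n |F|+5≡4n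

  Low : V → Set
  Low x = deg x ≤ 3

  Weak : Fin n → V → Set
  Weak m x = degWithout m x ≤ 1

  Blocked : Fin n → V → Set
  Blocked m x = free x m ≡ 0

  AtMostOneWeak : Fin n → Set
  AtMostOneWeak m = ∀ x y → Weak m x → Weak m y → x ≡ y

  -- Alternatives (1) and (2) of the lemma, in terms of the counts of the fault set.
  Good₁ : Fin n → Set
  Good₁ m = 3 ≤ dimFaults m × (∀ x → 2 ≤ degWithout m x)

  Good₂ : Fin n → Set
  Good₂ m = 2 ≤ dimFaults m × (∀ x → 1 ≤ degWithout m x) × AtMostOneWeak m

  Conclusion : Set
  Conclusion = (Σ (Fin n) Good₁) ⊎ (Σ (Fin n) λ m → Σ (Fin n) λ m' → m ≢ m' × Good₂ m × Good₂ m')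

  2≤⇒1≤ : ∀ {a} → 2 ≤ a → 1 ≤ a
  2≤⇒1≤ = ≤-trans (n≤1+n 1)

  3≤⇒2≤ : ∀ {a} → 3 ≤ a → 2 ≤ a
  3≤⇒2≤ = ≤-trans (n≤1+n 2)

  ≰2⇒≤1 : ∀ {a} → ¬ 2 ≤ a → a ≤ 1
  ≰2⇒≤1 = ≤-pred ∘ ≰⇒>

  2≤⇒¬Weak : ∀ {m x} → 2 ≤ degWithout m x → ¬ Weak m x
  2≤⇒¬Weak 2≤ weak = ≤⇒≯ weak 2≤

  2≤deg : ∀ x → 2 ≤ deg x
  2≤deg x = Deg≥2⇒2≤deg x (δ≥2 x)

  free≤degWithout : ∀ {m b} x → m ≢ b → free x m ≤ degWithout b x
  free≤degWithout x m≢b = ≤-sum-removeAt (free x) m≢b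

  ¬Low⇒2≤degWithout : ∀ m x → ¬ Low x → 2 ≤ degWithout m x
  ¬Low⇒2≤degWithout m x ¬low = +-cancelˡ-≤ 2 2 _ (begin
    4                         ≤⟨ ≰⇒> ¬low ⟩
    deg x                     ≡⟨ deg-split x m ⟩
    free x m + degWithout m x ≤⟨ +-monoˡ-≤ _ (free≤2 x m) ⟩
    2 + degWithout m x        ∎)
    where open ≤-Reasoning

  Weak⇒Low : ∀ {m x} → Weak m x → Low x
  Weak⇒Low {m} {x} weak = subst (_≤ 3) (sym (deg-split x m)) (+-mono-≤ (free≤2 x m) weak)

  Blocked⇒2≤degWithout : ∀ {m x} → Blocked m x → 2 ≤ degWithout m x
  Blocked⇒2≤degWithout {m} {x} blocked = subst (2 ≤_) (trans (deg-split x m) (cong (_+ degWithout m x) blocked)) (2≤deg x)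

  Blocked⇒2≤dimFaults : ∀ {m x} → Blocked m x → 2 ≤ dimFaults m
  Blocked⇒2≤dimFaults {m} {x} blocked =
    subst (_≤ dimFaults m) (trans (sym (cong (_+ faultsAtIn x m) blocked)) (free-+-faultsAtIn x m)) (faultsAtIn≤dimFaults x m)

  Blocked²⇒3≤dimFaults : ∀ {m x y} → x ≢ y → Blocked m x → Blocked m y → 3 ≤ dimFaults m
  Blocked²⇒3≤dimFaults {m} {x} {y} x≢y bx by = ≤-pred (begin
    4                                   ≡⟨ cong₂ _+_ (faultsAtIn≡2 bx) (faultsAtIn≡2 by) ⟨
    faultsAtIn x m + faultsAtIn y m     ≤⟨ faultsAtIn-pair x y m ⟩
    dimFaults m + faultsBetween x y     ≤⟨ +-monoʳ-≤ (dimFaults m) (faultsBetween≤1 x≢y) ⟩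
    dimFaults m + 1                     ≡⟨ +-comm (dimFaults m) 1 ⟩
    suc (dimFaults m)                   ∎)
    where
    open ≤-Reasoning
    faultsAtIn≡2 : ∀ {z} → Blocked m z → faultsAtIn z m ≡ 2
    faultsAtIn≡2 {z} blocked = trans (sym (cong (_+ faultsAtIn z m) blocked)) (free-+-faultsAtIn z m)

  three-faulty⇒2≤dimFaults : ∀ {m x y z} → x ≢ y → x ≢ z → y ≢ z →
    free x m ≤ 1 → free y m ≤ 1 → free z m ≤ 1 → 2 ≤ dimFaults m
  three-faulty⇒2≤dimFaults {m} {x} {y} {z} x≢y x≢z y≢z fx fy fz =
    half (≤-trans (+-mono-≤ (+-mono-≤ (free≤1⇒1≤faultsAtIn fx) (free≤1⇒1≤faultsAtIn fy)) (free≤1⇒1≤faultsAtIn fz))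
      (faultsAtIn-triple m x≢y x≢z y≢z))
    where
    half : ∀ {c} → 3 ≤ c + c → 2 ≤ c
    half {suc (suc c)} _ = s≤s (s≤s z≤n)
    half {suc zero} (s≤s (s≤s ()))

  ¬Blocked⇒1≤free : ∀ {m x} → ¬ Blocked m x → 1 ≤ free x m
  ¬Blocked⇒1≤free = n≢0⇒n>0

  two-other-dims : ∀ b → Σ (Fin n) λ m₁ → Σ (Fin n) λ m₂ → m₁ ≢ m₂ × m₁ ≢ b × m₂ ≢ b
  two-other-dims b = punchIn b zero , punchIn b (suc zero) ,
    (λ eq → contradiction (punchIn-injective b zero (suc zero) eq) λ ()) ,
    punchInᵢ≢i b zero , punchInᵢ≢i b (suc zero)

  third-dim : ∀ a b → Σ (Fin n) λ c → c ≢ a × c ≢ b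
  third-dim a b with two-other-dims a
  ... | c₁ , c₂ , c₁≢c₂ , c₁≢a , c₂≢a with c₁ ≟ᶠ b
  ...   | yes refl = c₂ , c₂≢a , c₁≢c₂ ∘ sym
  ...   | no c₁≢b = c₁ , c₁≢a , c₁≢b

  isolated⇒Blocked : ∀ {b m x} → degWithout b x ≡ 0 → m ≢ b → Blocked m x
  isolated⇒Blocked {m = m} {x} isolated m≢b = n≤0⇒n≡0 (subst (free x m ≤_) isolated (free≤degWithout x m≢b))

  -- Since n ≥ 3, removing dimension b still leaves two dimensions whose free degrees sum to at most 1.
  Weak⇒Blocked-elsewhere : ∀ {b x} → Weak b x → Σ (Fin n) λ m → m ≢ b × Blocked m x
  Weak⇒Blocked-elsewhere {b} {x} weak
    with one-zero (free x (punchIn b zero)) (free x (punchIn b (suc zero)))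
           (≤-trans (+-≤-sum (free x ∘ punchIn b) (λ ())) weak)
    where
    one-zero : ∀ a c → a + c ≤ 1 → a ≡ 0 ⊎ c ≡ 0
    one-zero zero c _ = inj₁ refl
    one-zero (suc a) c (s≤s a+c≤0) = inj₂ (n≤0⇒n≡0 (≤-trans (m≤n+m c a) a+c≤0))
  ... | inj₁ blocked = punchIn b zero , punchInᵢ≢i b zero , blocked
  ... | inj₂ blocked = punchIn b (suc zero) , punchInᵢ≢i b (suc zero) , blocked

  Weak⇒¬isolated-elsewhere : ∀ {b p x} → Weak b x → p ≢ b → degWithout p x ≢ 0
  Weak⇒¬isolated-elsewhere {b} {p} {x} weak p≢b isolated =
    ≤⇒≯ (≤-trans (free≤degWithout x p≢b) weak) (subst (2 ≤_) deg≡free (2≤deg x))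
    where
    deg≡free : deg x ≡ free x p
    deg≡free = trans (deg-split x p) (trans (cong (free x p +_) isolated) (+-identityʳ _))

  ∃-dim-with-3-faults : Σ (Fin n) λ b → 3 ≤ dimFaults b
  ∃-dim-with-3-faults with Finₚ.any? (λ m → 3 ≤? dimFaults m)
  ... | yes found = found
  ... | no none = ⊥-elim (faults-exceed-2n length≤sum-dimFaults (sum-≤-* 2 λ m → ≤-pred (≰⇒> (none ∘ (m ,_)))))

  deg+sum-faultsAtIn : ∀ x → deg x + sum (faultsAtIn x) ≡ n * 2
  deg+sum-faultsAtIn x = trans (sym (∑-distrib-+ (free x) (faultsAtIn x)))
    (trans (sum-cong-≗ (free-+-faultsAtIn x)) (sum-const n 2))

  Low⇒2n≤faultsAt+3 : ∀ {x} → Low x → n * 2 ≤ faultsAt x + 3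
  Low⇒2n≤faultsAt+3 {x} low = begin
    n * 2                        ≡⟨ deg+sum-faultsAtIn x ⟨
    deg x + sum (faultsAtIn x)   ≤⟨ +-mono-≤ low (sum-faultsAtIn≤faultsAt x) ⟩
    3 + faultsAt x               ≡⟨ +-comm 3 (faultsAt x) ⟩
    faultsAt x + 3               ∎
    where open ≤-Reasoning

  no-four-Low : ∀ {a b c d} → a ≢ b → a ≢ c → a ≢ d → b ≢ c → b ≢ d → c ≢ d →
    Low a → Low b → Low c → Low d → ⊥
  no-four-Low {a} {b} {c} {d} a≢b a≢c a≢d b≢c b≢d c≢d la lb lc ld =
    no-four-lows-arith (Low⇒2n≤faultsAt+3 la) (Low⇒2n≤faultsAt+3 lb) (Low⇒2n≤faultsAt+3 lc) (Low⇒2n≤faultsAt+3 ld)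
      (≤-trans (faultsAt-quadruple a b c d) (+-monoʳ-≤ (length F) (≤-trans
        (+-mono-≤ (+-mono-≤ (+-mono-≤ (+-mono-≤ (+-mono-≤
          (faultsBetween≤xor a≢b) (faultsBetween≤xor a≢c)) (faultsBetween≤xor a≢d))
          (faultsBetween≤xor b≢c)) (faultsBetween≤xor b≢d)) (faultsBetween≤xor c≢d))
        (bipartite₄ (parity a) (parity b) (parity c) (parity d)))))

  three-Low⇒deg≡3 : ∀ {a b c} → a ≢ b → a ≢ c → b ≢ c → Low a → Low b → Low c → deg a ≡ 3
  three-Low⇒deg≡3 {a} {b} {c} a≢b a≢c b≢c la lb lc =
    ≤-antisym la (3≤complement (trans (+-comm (sum (faultsAtIn a)) (deg a)) (deg+sum-faultsAtIn a))
                               (≤-trans (sum-faultsAtIn≤faultsAt a) faultsAt≤3))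
    where
    faultsAt≤3 : faultsAt a ≤ 3
    faultsAt≤3 = three-lows-arith (Low⇒2n≤faultsAt+3 lb) (Low⇒2n≤faultsAt+3 lc)
      (≤-trans (faultsAt-triple a b c) (+-monoʳ-≤ (length F) (≤-trans
        (+-mono-≤ (+-mono-≤ (faultsBetween≤xor a≢b) (faultsBetween≤xor a≢c)) (faultsBetween≤xor b≢c))
        (bipartite₃ (parity a) (parity b) (parity c)))))

  Complete : List V → Set
  Complete L = ∀ z → Low z → z ∈ L

  Complete-↭ : ∀ {L L'} → Complete L → L ↭ L' → Complete L'
  Complete-↭ complete L↭L' z low = ∈-resp-↭ L↭L' (complete z low)

  new-low? : ∀ L → Complete L ⊎ Σ V λ z → Low z × z ∉ L
  new-low? L with ∃-vertex? (λ z → Low z × z ∉ L) (λ z → (deg z ≤? 3) ×-dec ¬? (z ∈? L))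
  ... | yes (z , low , z∉L) = inj₂ (z , low , z∉L)
  ... | no none = inj₁ λ z low → decidable-stable (z ∈? L) λ z∉L → none (z , low , z∉L)

  NotBothWeak : Fin n → V → V → Set
  NotBothWeak m a b = ¬ (Weak m a × Weak m b)

  module _ {L : List V} (complete : Complete L) where

    weak-unique : ∀ {m} → AllPairs (NotBothWeak m) L → AtMostOneWeak m
    weak-unique pairs x y wx wy with AllPairs-∈ pairs (complete x (Weak⇒Low wx)) (complete y (Weak⇒Low wy))
    ... | inj₁ x≡y = x≡y
    ... | inj₂ (inj₁ ¬both) = contradiction (wx , wy) ¬both
    ... | inj₂ (inj₂ ¬both) = contradiction (wy , wx) ¬both

    everywhere : ∀ m {Q : V → Set} → (∀ z → 2 ≤ degWithout m z → Q z) → All Q L → ∀ z → Q z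
    everywhere m base lows z with deg z ≤? 3
    ... | no ¬low = base z (¬Low⇒2≤degWithout m z ¬low)
    ... | yes low = All.lookup lows (complete z low)

    good₁ : ∀ {m} → 3 ≤ dimFaults m → All (λ z → 2 ≤ degWithout m z) L → Good₁ m
    good₁ {m} 3≤ lows = 3≤ , everywhere m (λ _ 2≤ → 2≤) lows

    good₂ : ∀ {m} → 2 ≤ dimFaults m → All (λ z → 1 ≤ degWithout m z) L → AllPairs (NotBothWeak m) L → Good₂ m
    good₂ {m} 2≤ lows pairs = 2≤ , everywhere m (λ _ → 2≤⇒1≤) lows , weak-unique pairs

  no-low : Complete [] → Conclusion
  no-low complete with ∃-dim-with-3-faults
  ... | b , 3≤b = inj₁ (b , good₁ complete 3≤b [])

  module OneLow (u : V) (complete : Complete [ u ]) where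

    Blocked⇒Good₂ : ∀ {m} → Blocked m u → Good₂ m
    Blocked⇒Good₂ blocked =
      good₂ complete (Blocked⇒2≤dimFaults blocked) (2≤⇒1≤ (Blocked⇒2≤degWithout blocked) ∷ []) ([] ∷ [])

    conclusion : Conclusion
    conclusion with ∃-dim-with-3-faults
    ... | b , 3≤b with 2 ≤? degWithout b u
    ...   | yes 2≤u = inj₁ (b , good₁ complete 3≤b (2≤u ∷ []))
    ...   | no ¬2≤u with degWithout b u ≟ 0
    ...     | yes isolated with two-other-dims b
    ...       | m₁ , m₂ , m₁≢m₂ , m₁≢b , m₂≢b =
      inj₂ (m₁ , m₂ , m₁≢m₂ , Blocked⇒Good₂ (isolated⇒Blocked isolated m₁≢b) , Blocked⇒Good₂ (isolated⇒Blocked isolated m₂≢b))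
    conclusion | b , 3≤b | no ¬2≤u | no ¬isolated with Weak⇒Blocked-elsewhere (≰2⇒≤1 ¬2≤u)
    ... | m , m≢b , blocked =
      inj₂ (b , m , m≢b ∘ sym , good₂ complete (3≤⇒2≤ 3≤b) (n≢0⇒n>0 ¬isolated ∷ []) ([] ∷ []) , Blocked⇒Good₂ blocked)

  record TwoLows (x y : V) : Set where
    field
      x≢y : x ≢ y
      complete : Complete (x ∷ y ∷ [])
      apart : ∀ m → Blocked m x → Blocked m y → ⊥

    only-x-weak : ∀ {m} → 2 ≤ degWithout m y → AllPairs (NotBothWeak m) (x ∷ y ∷ [])
    only-x-weak 2≤y = ((2≤⇒¬Weak 2≤y ∘ proj₂) ∷ []) ∷ [] ∷ []

    only-y-weak : ∀ {m} → 2 ≤ degWithout m x → AllPairs (NotBothWeak m) (x ∷ y ∷ [])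
    only-y-weak 2≤x = ((2≤⇒¬Weak 2≤x ∘ proj₁) ∷ []) ∷ [] ∷ []

    blocked-y⇒Good₂ : ∀ {m} → Blocked m y → 1 ≤ degWithout m x → Good₂ m
    blocked-y⇒Good₂ by x-ok =
      good₂ complete (Blocked⇒2≤dimFaults by) (x-ok ∷ 2≤⇒1≤ (Blocked⇒2≤degWithout by) ∷ []) (only-x-weak (Blocked⇒2≤degWithout by))

    blocked-x⇒Good₂ : ∀ {m} → Blocked m x → 1 ≤ degWithout m y → Good₂ m
    blocked-x⇒Good₂ bx y-ok =
      good₂ complete (Blocked⇒2≤dimFaults bx) (2≤⇒1≤ (Blocked⇒2≤degWithout bx) ∷ y-ok ∷ []) (only-y-weak (Blocked⇒2≤degWithout bx))

  swap-TwoLows : ∀ {x y} → TwoLows x y → TwoLows y x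
  swap-TwoLows t = record
    { x≢y = x≢y ∘ sym
    ; complete = Complete-↭ complete (swap _ _ ↭-refl)
    ; apart = λ m by bx → apart m bx by
    }
    where open TwoLows t

  module _ {x y : V} (t : TwoLows x y) where
    open TwoLows t

    y-isolated : ∀ b → degWithout b y ≡ 0 → Conclusion
    y-isolated b isolated with two-other-dims b
    ... | m₁ , m₂ , m₁≢m₂ , m₁≢b , m₂≢b = inj₂ (m₁ , m₂ , m₁≢m₂ , good m₁≢b m₂≢b m₁≢m₂ , good m₂≢b m₁≢b (m₁≢m₂ ∘ sym))
      where
      -- x cannot also be blocked at m', so its free m'-edge survives the removal of dimension m.
      good : ∀ {m m'} → m ≢ b → m' ≢ b → m ≢ m' → Good₂ m
      good {m} {m'} m≢b m'≢b m≢m' = blocked-y⇒Good₂ (isolated⇒Blocked isolated m≢b)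
        (≤-trans (¬Blocked⇒1≤free λ bx → apart m' bx (isolated⇒Blocked isolated m'≢b)) (free≤degWithout x (m≢m' ∘ sym)))

  y-weak : ∀ {x y} → TwoLows x y → ∀ b → 3 ≤ dimFaults b → Weak b y → Conclusion
  y-weak {x} {y} t b 3≤b wy with degWithout b y ≟ 0
  ... | yes y-iso = y-isolated t b y-iso
  ... | no ¬y-iso with Weak⇒Blocked-elsewhere wy
  ...   | m , m≢b , by with 2 ≤? degWithout b x
  ...     | yes 2≤x = x-strong-at-b
    where
    open TwoLows t
    good-b : Good₂ b
    good-b = good₂ complete (3≤⇒2≤ 3≤b) (2≤⇒1≤ 2≤x ∷ n≢0⇒n>0 ¬y-iso ∷ []) (only-y-weak 2≤x)
    x-strong-at-b : Conclusion
    x-strong-at-b with degWithout m x ≟ 0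
    ... | no ¬x-iso = inj₂ (b , m , m≢b ∘ sym , good-b , blocked-y⇒Good₂ by (n≢0⇒n>0 ¬x-iso))
    ... | yes x-iso with third-dim b m
    ...   | c , c≢b , c≢m = inj₂ (b , c , c≢b ∘ sym , good-b , blocked-x⇒Good₂ (isolated⇒Blocked x-iso c≢m) y-at-c)
      where
      -- x is blocked at b as well, hence y is not, and its free b-edge survives the removal of dimension c.
      y-at-c : 1 ≤ degWithout c y
      y-at-c = ≤-trans (¬Blocked⇒1≤free (apart b (isolated⇒Blocked x-iso (m≢b ∘ sym)))) (free≤degWithout y (c≢b ∘ sym))
  ...     | no ¬2≤x with degWithout b x ≟ 0
  ...       | yes x-iso = y-isolated (swap-TwoLows t) b x-iso
  ...       | no ¬x-iso with Weak⇒Blocked-elsewhere (≰2⇒≤1 ¬2≤x)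
  ...         | p , p≢b , bx = inj₂ (p , m , p≢m ,
                  blocked-x⇒Good₂ bx (n≢0⇒n>0 (Weak⇒¬isolated-elsewhere wy p≢b)) ,
                  blocked-y⇒Good₂ by (n≢0⇒n>0 (Weak⇒¬isolated-elsewhere (≰2⇒≤1 ¬2≤x) m≢b)))
    where
    open TwoLows t
    p≢m : p ≢ m
    p≢m refl = apart p bx by

  two-lows-apart : ∀ {x y} → TwoLows x y → Conclusion
  two-lows-apart {x} {y} t with ∃-dim-with-3-faults
  ... | b , 3≤b with 2 ≤? degWithout b x | 2 ≤? degWithout b y
  ...   | yes 2≤x | yes 2≤y = inj₁ (b , good₁ (TwoLows.complete t) 3≤b (2≤x ∷ 2≤y ∷ []))
  ...   | _ | no ¬2≤y = y-weak t b 3≤b (≰2⇒≤1 ¬2≤y)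
  ...   | no ¬2≤x | yes _ = y-weak (swap-TwoLows t) b 3≤b (≰2⇒≤1 ¬2≤x)

  two-lows : ∀ {x y} → x ≢ y → Complete (x ∷ y ∷ []) → Conclusion
  two-lows {x} {y} x≢y complete with Finₚ.any? (λ m → (free x m ≟ 0) ×-dec (free y m ≟ 0))
  ... | yes (m , bx , by) =
    inj₁ (m , good₁ complete (Blocked²⇒3≤dimFaults x≢y bx by) (Blocked⇒2≤degWithout bx ∷ Blocked⇒2≤degWithout by ∷ []))
  ... | no none = two-lows-apart record { x≢y = x≢y ; complete = complete ; apart = λ m bx by → none (m , bx , by) }

  TwoWeak : Fin n → V → V → V → Set
  TwoWeak κ u v w = (Weak κ u × Weak κ v) ⊎ (Weak κ u × Weak κ w) ⊎ (Weak κ v × Weak κ w)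

  TwoWeak? : ∀ κ u v w → Dec (TwoWeak κ u v w)
  TwoWeak? κ u v w = (weak? u ×-dec weak? v) ⊎-dec (weak? u ×-dec weak? w) ⊎-dec (weak? v ×-dec weak? w)
    where
    weak? : ∀ t → Dec (Weak κ t)
    weak? t = degWithout κ t ≤? 1

  module ThreeLows (deg≡3 : ∀ t → Low t → deg t ≡ 3) where

    1≤degWithout : ∀ m t → 1 ≤ degWithout m t
    1≤degWithout m t with deg t ≤? 3
    ... | no ¬low = 2≤⇒1≤ (¬Low⇒2≤degWithout m t ¬low)
    ... | yes low = +-cancelˡ-≤ 2 1 _ (subst (_≤ 2 + degWithout m t) (trans (sym (deg-split t m)) (deg≡3 t low))
                                              (+-monoˡ-≤ _ (free≤2 t m)))

    Weak⇒2≤free : ∀ {m t} → Weak m t → 2 ≤ free t m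
    Weak⇒2≤free {m} {t} weak = +-cancelʳ-≤ 1 2 (free t m)
      (subst (_≤ free t m + 1) (trans (sym (deg-split t m)) (deg≡3 t (Weak⇒Low weak))) (+-monoʳ-≤ (free t m) weak))

    weak-elsewhere : ∀ {κ m t} → Weak κ t → m ≢ κ → ¬ Weak m t
    weak-elsewhere {t = t} wκ m≢κ wm = ≤⇒≯ (≤-trans (free≤degWithout t m≢κ) wκ) (Weak⇒2≤free wm)

    good₂′ : ∀ {L m} → Complete L → 2 ≤ dimFaults m → AllPairs (NotBothWeak m) L → Good₂ m
    good₂′ complete 2≤ pairs = 2≤ , 1≤degWithout _ , weak-unique complete pairs

    module PairWeak {x y z : V} (x≢y : x ≢ y) (x≢z : x ≢ z) (y≢z : y ≢ z) (complete : Complete (x ∷ y ∷ z ∷ []))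
                    {κ : Fin n} (wx : Weak κ x) (wy : Weak κ y) where

      only-z : ∀ {m} → m ≢ κ → 2 ≤ dimFaults m → Good₂ m
      only-z m≢κ 2≤ = good₂′ complete 2≤
        (((weak-elsewhere wx m≢κ ∘ proj₁) ∷ (weak-elsewhere wx m≢κ ∘ proj₁) ∷ []) ∷ ((weak-elsewhere wy m≢κ ∘ proj₁) ∷ []) ∷ [] ∷ [])

      common-blocked : ∀ {d} → d ≢ κ → Blocked d x → Blocked d y → Conclusion
      common-blocked {d} d≢κ bx by with 2 ≤? degWithout d z
      ... | yes 2≤z =
        inj₁ (d , good₁ complete (Blocked²⇒3≤dimFaults x≢y bx by) (Blocked⇒2≤degWithout bx ∷ Blocked⇒2≤degWithout by ∷ 2≤z ∷ []))
      ... | no ¬2≤z with Weak⇒Blocked-elsewhere (≰2⇒≤1 ¬2≤z)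
      ...   | dz , dz≢d , bz with dz ≟ᶠ κ
      ...     | no dz≢κ = inj₂ (d , dz , dz≢d ∘ sym ,
                  only-z d≢κ (3≤⇒2≤ (Blocked²⇒3≤dimFaults x≢y bx by)) , only-z dz≢κ (Blocked⇒2≤dimFaults bz))
      -- z is blocked at κ, so a free edge of z outside d lies in a dimension e ∉ {d, κ};
      -- there each of x, y, z has a faulty edge, and three vertices need two distinct faulty edges.
      ...     | yes refl with sum-≥1 (free z ∘ punchIn d) (1≤degWithout d z)
      ...       | i , 1≤free = inj₂ (d , e , e≢d ∘ sym ,
                  only-z d≢κ (3≤⇒2≤ (Blocked²⇒3≤dimFaults x≢y bx by)) ,
                  only-z e≢κ (three-faulty⇒2≤dimFaults x≢y x≢z y≢z
                    (≤-trans (free≤degWithout x e≢κ) wx) (≤-trans (free≤degWithout y e≢κ) wy)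
                    (≤-trans (free≤degWithout z e≢d) (≰2⇒≤1 ¬2≤z))))
        where
        e : Fin n
        e = punchIn d i
        e≢d : e ≢ d
        e≢d = punchInᵢ≢i d i
        e≢κ : e ≢ κ
        e≢κ refl = contradiction (subst (1 ≤_) bz 1≤free) λ ()

      conclusion : Conclusion
      conclusion with Weak⇒Blocked-elsewhere wx | Weak⇒Blocked-elsewhere wy
      ... | dx , dx≢κ , bx | dy , dy≢κ , by with dx ≟ᶠ dy
      ...   | no dx≢dy = inj₂ (dx , dy , dx≢dy , only-z dx≢κ (Blocked⇒2≤dimFaults bx) , only-z dy≢κ (Blocked⇒2≤dimFaults by))
      ...   | yes refl = common-blocked dx≢κ bx by

    module NoTwoWeak {u v w : V} (complete : Complete (u ∷ v ∷ w ∷ [])) (no-two : ∀ κ → ¬ TwoWeak κ u v w) where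

      pairs : ∀ m → AllPairs (NotBothWeak m) (u ∷ v ∷ w ∷ [])
      pairs m = ((no-two m ∘ inj₁) ∷ (no-two m ∘ inj₂ ∘ inj₁) ∷ []) ∷ ((no-two m ∘ inj₂ ∘ inj₂) ∷ []) ∷ [] ∷ []

      weak-at : ∀ {b t} → 3 ≤ dimFaults b → Weak b t → Conclusion
      weak-at {b} 3≤b wt with Weak⇒Blocked-elsewhere wt
      ... | m , m≢b , bt =
        inj₂ (b , m , m≢b ∘ sym , good₂′ complete (3≤⇒2≤ 3≤b) (pairs b) , good₂′ complete (Blocked⇒2≤dimFaults bt) (pairs m))

      conclusion : Conclusion
      conclusion with ∃-dim-with-3-faults
      ... | b , 3≤b with degWithout b u ≤? 1 | degWithout b v ≤? 1 | degWithout b w ≤? 1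
      ...   | yes wu | _ | _ = weak-at 3≤b wu
      ...   | no _ | yes wv | _ = weak-at 3≤b wv
      ...   | no _ | no _ | yes ww = weak-at 3≤b ww
      ...   | no ¬wu | no ¬wv | no ¬ww = inj₁ (b , good₁ complete 3≤b (≰⇒> ¬wu ∷ ≰⇒> ¬wv ∷ ≰⇒> ¬ww ∷ []))

    three-lows : ∀ {u v w} → u ≢ v → u ≢ w → v ≢ w → Complete (u ∷ v ∷ w ∷ []) → Conclusion
    three-lows {u} {v} {w} u≢v u≢w v≢w complete with Finₚ.any? (λ κ → TwoWeak? κ u v w)
    ... | yes (κ , inj₁ (wu , wv)) = PairWeak.conclusion u≢v u≢w v≢w complete wu wv
    ... | yes (κ , inj₂ (inj₁ (wu , ww))) =
      PairWeak.conclusion u≢w u≢v (v≢w ∘ sym) (Complete-↭ complete (prep u (swap v w ↭-refl))) wu ww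
    ... | yes (κ , inj₂ (inj₂ (wv , ww))) =
      PairWeak.conclusion v≢w (u≢v ∘ sym) (u≢w ∘ sym)
        (Complete-↭ complete (↭-trans (swap u v ↭-refl) (prep v (swap u w ↭-refl)))) wv ww
    ... | no none = NoTwoWeak.conclusion complete λ κ two → none (κ , two)

  Low⇒deg≡3 : ∀ {u v w} → u ≢ v → u ≢ w → v ≢ w → Low u → Low v → Low w →
    Complete (u ∷ v ∷ w ∷ []) → ∀ t → Low t → deg t ≡ 3
  Low⇒deg≡3 u≢v u≢w v≢w lu lv lw complete t low with complete t low
  ... | here refl = three-Low⇒deg≡3 u≢v u≢w v≢w lu lv lw
  ... | there (here refl) = three-Low⇒deg≡3 (u≢v ∘ sym) v≢w u≢w lv lu lw
  ... | there (there (here refl)) = three-Low⇒deg≡3 (u≢w ∘ sym) (v≢w ∘ sym) u≢v lw lu lv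

  at-least-three : ∀ {u v w} → u ≢ v → u ≢ w → v ≢ w → Low u → Low v → Low w → Conclusion
  at-least-three {u} {v} {w} u≢v u≢w v≢w lu lv lw with new-low? (u ∷ v ∷ w ∷ [])
  ... | inj₁ complete = ThreeLows.three-lows (Low⇒deg≡3 u≢v u≢w v≢w lu lv lw complete) u≢v u≢w v≢w complete
  ... | inj₂ (y , ly , y∉) = ⊥-elim (no-four-Low u≢v u≢w (∉⇒≢ y∉ (here refl)) v≢w
                                       (∉⇒≢ y∉ (there (here refl))) (∉⇒≢ y∉ (there (there (here refl)))) lu lv lw ly)

  at-least-two : ∀ {u v} → u ≢ v → Low u → Low v → Conclusion
  at-least-two {u} {v} u≢v lu lv with new-low? (u ∷ v ∷ [])
  ... | inj₁ complete = two-lows u≢v complete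
  ... | inj₂ (w , lw , w∉) = at-least-three u≢v (∉⇒≢ w∉ (here refl)) (∉⇒≢ w∉ (there (here refl))) lu lv lw

  at-least-one : ∀ {u} → Low u → Conclusion
  at-least-one {u} lu with new-low? [ u ]
  ... | inj₁ complete = OneLow.conclusion u complete
  ... | inj₂ (v , lv , v∉) = at-least-two (∉⇒≢ v∉ (here refl)) lu lv

  conclusion : Conclusion
  conclusion with new-low? []
  ... | inj₁ complete = no-low complete
  ... | inj₂ (u , lu , _) = at-least-one lu

  Deg≡1⇒Weak : ∀ {m x} → Deg≡1 F (Dim m) x → Weak m x
  Deg≡1⇒Weak {m} {x} (_ , ¬deg≥2) = ≰2⇒≤1 (¬deg≥2 ∘ 2≤degWithout⇒Deg≥2 m x)

  Good₂⇒ : ∀ {m} → Good₂ m → DimCount≥ F m 2 × NoIsoAtMostOneDeg1 F (Dim m)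
  Good₂⇒ {m} (2≤ , 1≤ , unique) =
    ≤dimFaults⇒DimCount≥ m 2 2≤ ,
    (λ x → 1≤degWithout⇒Deg≥1 m x (1≤ x)) ,
    (λ x y deg₁x deg₁y → unique x y (Deg≡1⇒Weak deg₁x) (Deg≡1⇒Weak deg₁y))

  dichotomy : (Σ (Fin n) λ m → DimCount≥ F m 3 × MinDeg≥2 F (Dim m))
    ⊎ (Σ (Fin n) λ m → Σ (Fin n) λ m' → m ≢ m' ×
        DimCount≥ F m 2 × DimCount≥ F m' 2 ×
        NoIsoAtMostOneDeg1 F (Dim m) × NoIsoAtMostOneDeg1 F (Dim m'))
  dichotomy with conclusion
  ... | inj₁ (m , 3≤ , 2≤) = inj₁ (m , ≤dimFaults⇒DimCount≥ m 3 3≤ , λ x → 2≤degWithout⇒Deg≥2 m x (2≤ x))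
  ... | inj₂ (m , m' , m≢m' , good , good') with Good₂⇒ good | Good₂⇒ good'
  ...   | count , deg | count' , deg' = inj₂ (m , m' , m≢m' , count , count' , deg , deg')

lemma6 : (n : ℕ) → 3 ≤ n → (F : List (Edge n)) → IsEdgeSet F →
    length F ≡ 4 * n ∸ 5 → MinDeg≥2 F NoEdges →
    (Σ (Fin n) λ m → DimCount≥ F m 3 × MinDeg≥2 F (Dim m))
    ⊎ (Σ (Fin n) λ m → Σ (Fin n) λ m' → m ≢ m' ×
        DimCount≥ F m 2 × DimCount≥ F m' 2 ×
        NoIsoAtMostOneDeg1 F (Dim m) × NoIsoAtMostOneDeg1 F (Dim m'))
lemma6 (suc (suc (suc j))) _ F F-edges |F| δ≥2 = Main.dichotomy j F F-edges |F| δ≥2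
lemma6 zero () F
lemma6 (suc zero) (s≤s ()) F
lemma6 (suc (suc zero)) (s≤s (s≤s ())) F
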